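{- For every deterministic online algorithm $ALG$ for the online dominating set problem, $\rho(ALG, \text{SERIES-PARALLEL}) = \Omega(\sqrt{n})$, where $n$ is the number of vertices of the input graph.
   Context: Online dominating set model: an input is a finite, connected, simple, undirected graph $G=(V,E)$ together with an ordering $v_1,\dots,v_n$ of $V$ chosen by an adversary such that for every $i$ the subgraph induced on $\{v_1,\dots,v_i\}$ is connected. At step $i$, $v_i$ is revealed together with its entire closed neighbourhood $N[v_i]$ (including not yet revealed neighbours), and the algorithm irrevocably decides, before the next step, whether to select $v_i$; the selected set must be a dominating set of $G$. The algorithm does not know $G$ or $n$ in advance. $ALG$ is the number of selected vertices, $OPT$ the minimum dominating set size; $\rho(ALG,\mathrm{CLASS})$ denotes the (asymptotic) competitive ratio of $ALG$ on inputs whose graph lies in CLASS, measured here as a function of $n$. Series-parallel graphs: a two-terminal graph $(G,s,t)$ is a graph with a distinguished source $s$ and sink $t$. Parallel composition of $(G_1,s_1,t_1)$ and $(G_2,s_2,t_2)$ takes their disjoint union and merges $s_1$ with $s_2$ (new source) and $t_1$ with $t_2$ (new sink). Series composition takes their disjoint union and merges $t_1$ with $s_2$; $s_1$ is the new source and $t_2$ the new sink. A two-terminal series-parallel graph is one obtainable from copies of $K_2$ by a sequence of parallel and series compositions (intermediate multigraphs allowed). A simple graph is series-parallel if it is a two-terminal series-parallel graph for some choice of source and sink. -}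

module Defs where

open import Data.Nat using (ℕ; zero; suc; _+_; _*_; _∸_; _^_; _≤_; _<_; _≤ᵇ_; _≡ᵇ_)
open import Data.Bool using (Bool; true; false; _∨_; _∧_; if_then_else_)
open import Data.Fin using (Fin; toℕ; _≟_)
open import Data.Fin.Subset using (Subset; _∈_; ∣_∣)
open import Data.Fin.Permutation using (Permutation′; _⟨$⟩ʳ_; _⟨$⟩ˡ_)
open import Data.List using (List; []; _∷_; _++_; map; filterᵇ; length)
open import Data.List using () renaming (allFin to allFinL)
open import Data.Vec using (tabulate)
open import Data.Product using (_×_; _,_; Σ; ∃; ∃-syntax)
open import Data.Sum using (_⊎_)
open import Relation.Nullary using (does)
open import Relation.Binary.PropositionalEquality using (_≡_)

-- Simple graphs on vertex set Fin n (vertex labels = names chosen by the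
-- adversary), given by a symmetric irreflexive Boolean adjacency.

record Graph : Set where
  field
    n      : ℕ
    adj    : Fin n → Fin n → Bool
    sym    : ∀ u v → adj u v ≡ adj v u
    irrefl : ∀ v → adj v v ≡ false

data PathIn {n : ℕ} (adj : Fin n → Fin n → Bool) (S : Fin n → Set)
     : Fin n → Fin n → Set where
  here : ∀ {u} → PathIn adj S u u
  step : ∀ {u x w} → adj u x ≡ true → S x → PathIn adj S x w → PathIn adj S u w

InducedConnected : {n : ℕ} → (Fin n → Fin n → Bool) → (Fin n → Set) → Set
InducedConnected adj S = ∀ u w → S u → S w → PathIn adj S u w

-- A term denotes a multigraph on vertices
-- 0 .. size-1 (as natural numbers) with source 0 and sink 1, and an edge
-- list (a multiset of edges).

data SPTerm : Set where
  k2  : SPTerm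
  par : SPTerm → SPTerm → SPTerm
  ser : SPTerm → SPTerm → SPTerm

size : SPTerm → ℕ
size k2        = 2
size (par s t) = size s + size t ∸ 2
size (ser s t) = size s + size t ∸ 1

mapEdge : (ℕ → ℕ) → ℕ × ℕ → ℕ × ℕ
mapEdge f (a , b) = f a , f b

edges : SPTerm → List (ℕ × ℕ)
-- parallel: merge sources (0) and sinks (1); other vertices of the second
-- graph are shifted past those of the first.
-- series: sink of the first is merged with source of the second into the
-- new vertex (size s); the sink of the second becomes the new sink 1.
edges k2        = (0 , 1) ∷ []
edges (par s t) = edges s ++ map (mapEdge relabel) (edges t)
  where
  relabel : ℕ → ℕ
  relabel 0 = 0
  relabel 1 = 1
  relabel v = v + size s ∸ 2
edges (ser s t) = map (mapEdge relabel₁) (edges s) ++ map (mapEdge relabel₂) (edges t)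
  where
  relabel₁ : ℕ → ℕ
  relabel₁ 0 = 0
  relabel₁ 1 = size s
  relabel₁ v = v
  relabel₂ : ℕ → ℕ
  relabel₂ 0 = size s
  relabel₂ 1 = 1
  relabel₂ v = v + size s ∸ 1

multiplicity : SPTerm → ℕ → ℕ → ℕ
multiplicity t a b = length (filterᵇ isAB (edges t))
  where
  isAB : ℕ × ℕ → Bool
  isAB (x , y) = ((x ≡ᵇ a) ∧ (y ≡ᵇ b)) ∨ ((x ≡ᵇ b) ∧ (y ≡ᵇ a))

-- A simple graph is series-parallel if it is (isomorphic to) the multigraph
-- denoted by some two-terminal series-parallel term (any choice of
-- terminals), where that multigraph has each edge of G exactly once and no
-- other edges.
SeriesParallel : Graph → Set
SeriesParallel G =
  Σ SPTerm λ t → Σ (size t ≡ n) λ _ → Σ (Permutation′ n) λ φ →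
    ∀ u v → multiplicity t (toℕ (φ ⟨$⟩ʳ u)) (toℕ (φ ⟨$⟩ʳ v))
            ≡ (if adj u v then 1 else 0)
  where open Graph G

-- Inputs: a graph together with a revelation order v₀,…,v_{n-1}
-- (order ⟨$⟩ʳ i = vertex revealed at step i), every prefix inducing a
-- connected subgraph.

record Input : Set where
  field
    graph : Graph
  open Graph graph public
  field
    nonempty : 1 ≤ n
    order    : Permutation′ n
  position : Fin n → Fin n
  position v = order ⟨$⟩ˡ v
  field
    prefixConnected : ∀ (i : Fin n) →
      InducedConnected adj (λ v → toℕ (position v) ≤ toℕ i)

-- What is revealed about a vertex: its name and its closed neighbourhood
-- (names listed in increasing order, a canonical presentation of the set).
Revealed : Set
Revealed = ℕ × List ℕ

-- A deterministic online algorithm: given the revealed history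
-- (vertices v₀..v_i in order, each with its closed neighbourhood),
-- decide whether to select the current (last) vertex v_i.
-- It knows neither G nor n in advance.
OnlineAlg : Set
OnlineAlg = List Revealed → Bool

module _ (I : Input) where
  open Input I

  closedNbhd : Fin n → List ℕ
  closedNbhd v = map toℕ (filterᵇ (λ w → does (w ≟ v) ∨ adj v w) (allFinL n))

  reveal : Fin n → Revealed
  reveal v = toℕ v , closedNbhd v

  history : Fin n → List Revealed
  history i = map (λ j → reveal (order ⟨$⟩ʳ j))
                  (filterᵇ (λ j → toℕ j ≤ᵇ toℕ i) (allFinL n))

  selected : OnlineAlg → Subset n
  selected A = tabulate (λ v → A (history (position v)))

  ALG : OnlineAlg → ℕ
  ALG A = ∣ selected A ∣

  Dominating : Subset n → Set
  Dominating D = ∀ v → ∃[ w ] (w ∈ D × (w ≡ v ⊎ adj v w ≡ true))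

  IsOPT : ℕ → Set
  IsOPT k = (∃[ D ] (Dominating D × ∣ D ∣ ≡ k)) × (∀ D → Dominating D → k ≤ ∣ D ∣)

  nVertices : ℕ
  nVertices = n

SPInput : Input → Set
SPInput I = SeriesParallel (Input.graph I)

CorrectOnSP : OnlineAlg → Set
CorrectOnSP A = ∀ I → SPInput I → Dominating I (selected I A)

-- The inputs are chains of blocks glued in parallel between a source s and a sink t.
-- Block i is an edge from s to its hub hᵢ followed by a gadget between hᵢ and t with d
-- leaves: a book (every leaf adjacent to hᵢ and t) or a fan (the leaves form a path
-- ending in t and are all adjacent to hᵢ).  The vertices are revealed as s, then block
-- after block with the hub first, and t last, so whether the algorithm selects hᵢ does
-- not depend on the types of blocks i, i + 1, ….  On the all-book input it either
-- selects all r + 1 hubs, or it skips some hᵢ; then turn block i into a fan: hᵢ is still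
-- skipped, and the middle leaf of every triple of consecutive leaves must be dominated
-- within its triple, which costs d / 3 = r + 1.  Both inputs are dominated by {s, t, hᵢ},
-- so OPT ≤ 3, while ALG ≥ r + 1 and n = O(r²).

module Submission where

open import Defs
open import Data.Nat
open import Data.Nat.Properties
open import Data.Nat.Tactic.RingSolver using (solve-∀)
open import Data.Bool using (Bool; true; false; _∨_; _∧_; if_then_else_; not; T)
import Data.Bool.Properties as Bool
open import Data.Fin using (Fin; zero; suc; toℕ; fromℕ<)
open import Data.Fin.Properties using (toℕ-fromℕ<; toℕ-injective; toℕ<n)
import Data.Fin.Properties as Fin
open import Data.Fin.Subset using (Subset; _∈_; ∣_∣; _∪_; ⁅_⁆; inside; outside)
open import Data.Fin.Subset.Properties using (_∈?_; anySubset?; x∈⁅x⁆; ∣⁅x⁆∣≡1; x∈p∪q⁺)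
open import Data.Fin.Permutation using (Permutation′; permutation; _⟨$⟩ʳ_; _⟨$⟩ˡ_)
import Data.Fin.Permutation as Permutation
open import Data.Vec using (Vec; []; _∷_; tabulate; there)
open import Data.Vec.Properties using ([]=⇒lookup)
open import Data.List using (List; []; _∷_; _++_; map; filterᵇ; length)
open import Data.List using () renaming (allFin to allFinL)
open import Data.List.Properties using (map-cong; map-cong-local)
open import Data.List.Relation.Unary.All using (All; []; _∷_)
import Data.List.Relation.Unary.All as All
open import Data.List.Relation.Unary.All.Properties using (++⁺; map⁺; all-filter)
open import Data.Product using (_×_; _,_; proj₁; proj₂; Σ; ∃-syntax)
open import Data.Sum using (_⊎_; inj₁; inj₂; [_,_]′)
open import Data.Empty using (⊥; ⊥-elim)
open import Relation.Nullary using (¬_; Dec; yes; no; does)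
open import Relation.Nullary.Decidable using (T?; _×-dec_; _⊎-dec_)
open import Relation.Unary using (Decidable)
open import Relation.Binary.PropositionalEquality
open import Function using (_∘_)
open import Function.Bundles using (Equivalence)
open import Relation.Binary.Definitions using (tri<; tri≈; tri>)

≡⇒≡ᵇ≡true : ∀ {m n} → m ≡ n → (m ≡ᵇ n) ≡ true
≡⇒≡ᵇ≡true {m} {n} m≡n = Equivalence.to Bool.T-≡ (≡⇒≡ᵇ m n m≡n)

≡ᵇ≡true⇒≡ : ∀ m n → (m ≡ᵇ n) ≡ true → m ≡ n
≡ᵇ≡true⇒≡ m n eq = ≡ᵇ⇒≡ m n (Equivalence.from Bool.T-≡ eq)

≢⇒≡ᵇ≡false : ∀ {m n} → m ≢ n → (m ≡ᵇ n) ≡ false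
≢⇒≡ᵇ≡false {m} {n} m≢n = Bool.¬-not (m≢n ∘ ≡ᵇ≡true⇒≡ m n)

<⇒<ᵇ≡true : ∀ {m n} → m < n → (m <ᵇ n) ≡ true
<⇒<ᵇ≡true m<n = Equivalence.to Bool.T-≡ (<⇒<ᵇ m<n)

<ᵇ≡true⇒< : ∀ m n → (m <ᵇ n) ≡ true → m < n
<ᵇ≡true⇒< m n eq = <ᵇ⇒< m n (Equivalence.from Bool.T-≡ eq)

≮⇒<ᵇ≡false : ∀ {m n} → ¬ m < n → (m <ᵇ n) ≡ false
≮⇒<ᵇ≡false {m} {n} m≮n = Bool.¬-not (m≮n ∘ <ᵇ≡true⇒< m n)

<ᵇ≡false⇒≥ : ∀ m n → (m <ᵇ n) ≡ false → n ≤ m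
<ᵇ≡false⇒≥ m n eq = ≮⇒≥ λ m<n → subst T eq (<⇒<ᵇ m<n)

true≢false : true ≢ false
true≢false ()

indicator : Bool → ℕ
indicator true  = 1
indicator false = 0

count : (ℕ → Bool) → ℕ → ℕ
count g zero    = 0
count g (suc n) = indicator (g 0) + count (λ k → g (suc k)) n

count-+ : ∀ g m n → count g (m + n) ≡ count g m + count (λ k → g (m + k)) n
count-+ g zero    n = refl
count-+ g (suc m) n =
  trans (cong (indicator (g 0) +_) (count-+ (λ k → g (suc k)) m n)) (sym (+-assoc (indicator (g 0)) _ _))

count-mono-≤ : ∀ g {m n} → m ≤ n → count g m ≤ count g n
count-mono-≤ g {m} {n} m≤n = begin
  count g m                                       ≤⟨ m≤m+n _ _ ⟩
  count g m + count (λ k → g (m + k)) (n ∸ m)     ≡⟨ count-+ g m (n ∸ m) ⟨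
  count g (m + (n ∸ m))                           ≡⟨ cong (count g) (m+[n∸m]≡n m≤n) ⟩
  count g n                                       ∎
  where open ≤-Reasoning

count-window : ∀ g a m n → a + m ≤ n → count (λ k → g (a + k)) m ≤ count g n
count-window g a m n a+m≤n = begin
  count (λ k → g (a + k)) m               ≤⟨ m≤n+m _ _ ⟩
  count g a + count (λ k → g (a + k)) m   ≡⟨ count-+ g a m ⟨
  count g (a + m)                         ≤⟨ count-mono-≤ g a+m≤n ⟩
  count g n                               ∎
  where open ≤-Reasoning

count-pos : ∀ g {n} k → k < n → g k ≡ true → 1 ≤ count g n
count-pos g zero    (s≤s _)   gk rewrite gk = s≤s z≤n
count-pos g (suc k) (s≤s k<n) gk = ≤-trans (count-pos (λ j → g (suc j)) k k<n gk) (m≤n+m _ _)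

count-triples : ∀ R h → (∀ q → q < R → Σ ℕ λ k → k < 3 × h (q * 3 + k) ≡ true) → R ≤ count h (R * 3)
count-triples zero    h _   = z≤n
count-triples (suc R) h hit = subst (suc R ≤_) (sym (count-+ h 3 (R * 3)))
  (+-mono-≤ first (count-triples R (λ k → h (3 + k)) (λ q q<R → hit (suc q) (s≤s q<R))))
  where
  first : 1 ≤ count h 3
  first with hit 0 z<s
  ... | k , k<3 , hk = count-pos h k k<3 hk

member : ∀ {n} → Vec Bool n → ℕ → Bool
member []       _       = false
member (x ∷ xs) zero    = x
member (x ∷ xs) (suc k) = member xs k

∣∣≡count-member : ∀ {n} (p : Subset n) → ∣ p ∣ ≡ count (member p) n
∣∣≡count-member []          = refl
∣∣≡count-member (true ∷ p)  = cong suc (∣∣≡count-member p)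
∣∣≡count-member (false ∷ p) = ∣∣≡count-member p

∈⇒member : ∀ {n} (p : Subset n) (v : Fin n) → v ∈ p → member p (toℕ v) ≡ true
∈⇒member (x ∷ p) zero    v∈p         = []=⇒lookup v∈p
∈⇒member (x ∷ p) (suc v) (there v∈p) = ∈⇒member p v v∈p

member-tabulate : ∀ {n} (f : Fin n → Bool) (v : Fin n) → member (tabulate f) (toℕ v) ≡ f v
member-tabulate {suc n} f zero    = refl
member-tabulate {suc n} f (suc v) = member-tabulate (λ x → f (suc x)) v

least-or-none : ∀ {P : ℕ → Set} → Decidable P → ∀ m →
  (Σ ℕ λ k → P k × k ≤ m × (∀ j → j < k → ¬ P j)) ⊎ (∀ j → j ≤ m → ¬ P j)
least-or-none P? zero with P? 0
... | yes P0 = inj₁ (0 , P0 , z≤n , λ _ ())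
... | no ¬P0 = inj₂ λ { zero _ → ¬P0 }
least-or-none {P} P? (suc m) with least-or-none P? m
... | inj₁ (k , Pk , k≤m , below) = inj₁ (k , Pk , m≤n⇒m≤1+n k≤m , below)
... | inj₂ none with P? (suc m)
...   | yes P1+m = inj₁ (suc m , P1+m , ≤-refl , λ j j<1+m → none j (≤-pred j<1+m))
...   | no ¬P1+m = inj₂ none′
  where
  none′ : ∀ j → j ≤ suc m → ¬ P j
  none′ j j≤1+m with m≤n⇒m<n∨m≡n j≤1+m
  ... | inj₁ j<1+m = none j (≤-pred j<1+m)
  ... | inj₂ refl  = ¬P1+m

∣p∪q∣≤∣p∣+∣q∣ : ∀ {n} (p q : Subset n) → ∣ p ∪ q ∣ ≤ ∣ p ∣ + ∣ q ∣
∣p∪q∣≤∣p∣+∣q∣ []            []            = z≤n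
∣p∪q∣≤∣p∣+∣q∣ (inside  ∷ p) (x       ∷ q) = s≤s (≤-trans (∣p∪q∣≤∣p∣+∣q∣ p q) (+-monoʳ-≤ ∣ p ∣ (∣q∣≤∣x∷q∣ x q)))
  where
  ∣q∣≤∣x∷q∣ : ∀ x {n} (q : Subset n) → ∣ q ∣ ≤ ∣ x ∷ q ∣
  ∣q∣≤∣x∷q∣ inside  q = n≤1+n ∣ q ∣
  ∣q∣≤∣x∷q∣ outside q = ≤-refl
∣p∪q∣≤∣p∣+∣q∣ (outside ∷ p) (inside  ∷ q) = ≤-trans (s≤s (∣p∪q∣≤∣p∣+∣q∣ p q)) (≤-reflexive (sym (+-suc ∣ p ∣ ∣ q ∣)))
∣p∪q∣≤∣p∣+∣q∣ (outside ∷ p) (outside ∷ q) = ∣p∪q∣≤∣p∣+∣q∣ p q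

module _ (I : Input) where
  open Input I

  dominating? : ∀ D → Dec (Dominating I D)
  dominating? D = Fin.all? λ v → Fin.any? λ w → (w ∈? D) ×-dec ((w Fin.≟ v) ⊎-dec (adj v w Bool.≟ true))

  minimum-dominating : ∀ D → Dominating I D → Σ ℕ λ opt → IsOPT I opt × opt ≤ ∣ D ∣
  minimum-dominating D dominating with least-or-none (λ k → anySubset? λ D′ → dominating? D′ ×-dec (∣ D′ ∣ ≟ k)) ∣ D ∣
  ... | inj₁ (k , attained , k≤∣D∣ , below) =
    k , (attained , λ D′ dominating′ → ≮⇒≥ λ ∣D′∣<k → below ∣ D′ ∣ ∣D′∣<k (D′ , dominating′ , refl)) , k≤∣D∣
  ... | inj₂ none = ⊥-elim (none ∣ D ∣ ≤-refl (D , dominating , refl))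

all-or-counterexample : ∀ (g : ℕ → Bool) m → (∀ i → i ≤ m → g i ≡ true) ⊎ Σ ℕ λ i → i ≤ m × g i ≡ false
all-or-counterexample g m with g m in gm
... | false = inj₂ (m , ≤-refl , gm)
all-or-counterexample g zero    | true = inj₁ λ { zero _ → gm }
all-or-counterexample g (suc m) | true with all-or-counterexample g m
... | inj₂ (i , i≤m , gi) = inj₂ (i , m≤n⇒m≤1+n i≤m , gi)
... | inj₁ below = inj₁ λ i i≤1+m → [ (λ i<1+m → below i (≤-pred i<1+m)) , (λ { refl → gm }) ]′ (m≤n⇒m<n∨m≡n i≤1+m)

-- Edge multiplicities of series-parallel terms

isEdge : ℕ → ℕ → ℕ × ℕ → Bool
isEdge a b (x , y) = ((x ≡ᵇ a) ∧ (y ≡ᵇ b)) ∨ ((x ≡ᵇ b) ∧ (y ≡ᵇ a))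

-- multiplicity t a b unfolds to edgeCount (edges t) a b.
edgeCount : List (ℕ × ℕ) → ℕ → ℕ → ℕ
edgeCount L a b = length (filterᵇ (isEdge a b) L)

edgeCount-∷ : ∀ e L a b → edgeCount (e ∷ L) a b ≡ indicator (isEdge a b e) + edgeCount L a b
edgeCount-∷ e L a b with isEdge a b e
... | true  = refl
... | false = refl

edgeCount-++ : ∀ L₁ L₂ a b → edgeCount (L₁ ++ L₂) a b ≡ edgeCount L₁ a b + edgeCount L₂ a b
edgeCount-++ []       L₂ a b = refl
edgeCount-++ (e ∷ L₁) L₂ a b = begin
  edgeCount (e ∷ L₁ ++ L₂) a b                               ≡⟨ edgeCount-∷ e (L₁ ++ L₂) a b ⟩
  indicator (isEdge a b e) + edgeCount (L₁ ++ L₂) a b         ≡⟨ cong (indicator (isEdge a b e) +_) (edgeCount-++ L₁ L₂ a b) ⟩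
  indicator (isEdge a b e) + (edgeCount L₁ a b + edgeCount L₂ a b) ≡⟨ +-assoc (indicator (isEdge a b e)) _ _ ⟨
  indicator (isEdge a b e) + edgeCount L₁ a b + edgeCount L₂ a b   ≡⟨ cong (_+ edgeCount L₂ a b) (edgeCount-∷ e L₁ a b) ⟨
  edgeCount (e ∷ L₁) a b + edgeCount L₂ a b                  ∎
  where open ≡-Reasoning

edgeCount-sym : ∀ L a b → edgeCount L a b ≡ edgeCount L b a
edgeCount-sym []      a b = refl
edgeCount-sym (e ∷ L) a b = begin
  edgeCount (e ∷ L) a b                             ≡⟨ edgeCount-∷ e L a b ⟩
  indicator (isEdge a b e) + edgeCount L a b        ≡⟨ cong₂ _+_ (cong indicator (isEdge-sym e)) (edgeCount-sym L a b) ⟩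
  indicator (isEdge b a e) + edgeCount L b a        ≡⟨ edgeCount-∷ e L b a ⟨
  edgeCount (e ∷ L) b a                             ∎
  where
  open ≡-Reasoning
  isEdge-sym : ∀ e → isEdge a b e ≡ isEdge b a e
  isEdge-sym (x , y) = Bool.∨-comm ((x ≡ᵇ a) ∧ (y ≡ᵇ b)) ((x ≡ᵇ b) ∧ (y ≡ᵇ a))

EdgesBelow : ℕ → List (ℕ × ℕ) → Set
EdgesBelow M = All (λ e → proj₁ e < M × proj₂ e < M)

edgeCount-outside : ∀ {M} a b L → EdgesBelow M L → M ≤ a → edgeCount L a b ≡ 0
edgeCount-outside a b []            []                   M≤a = refl
edgeCount-outside a b ((x , y) ∷ L) ((x<M , y<M) ∷ below) M≤a
  rewrite ≢⇒≡ᵇ≡false (λ x≡a → <⇒≱ x<M (subst (_ ≤_) (sym x≡a) M≤a))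
        | ≢⇒≡ᵇ≡false (λ y≡a → <⇒≱ y<M (subst (_ ≤_) (sym y≡a) M≤a))
        | Bool.∧-zeroʳ (x ≡ᵇ b)
  = edgeCount-outside a b L below M≤a

OnlyPreimage : (ℕ → ℕ) → ℕ → ℕ → ℕ → Set
OnlyPreimage f M a a′ = ∀ x → x < M → (x ≡ a′ → f x ≡ a) × (f x ≡ a → x ≡ a′)

retraction⇒OnlyPreimage : ∀ {f g M} → (∀ x → x < M → g (f x) ≡ x) → ∀ a → (g a < M → f (g a) ≡ a) →
                          OnlyPreimage f M a (g a)
retraction⇒OnlyPreimage {f} {g} gf a fg x x<M =
  (λ { refl → fg x<M }) , (λ fx≡a → trans (sym (gf x x<M)) (cong g fx≡a))

≡ᵇ-cong : ∀ {p q p′ q′} → (p ≡ q → p′ ≡ q′) → (p′ ≡ q′ → p ≡ q) → (p ≡ᵇ q) ≡ (p′ ≡ᵇ q′)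
≡ᵇ-cong {p} {q} ⇒ ⇐ with p ≟ q
... | yes p≡q = trans (≡⇒≡ᵇ≡true p≡q) (sym (≡⇒≡ᵇ≡true (⇒ p≡q)))
... | no  p≢q = trans (≢⇒≡ᵇ≡false p≢q) (sym (≢⇒≡ᵇ≡false (λ e → p≢q (⇐ e))))

edgeCount-map : ∀ f {M} a b a′ b′ L → EdgesBelow M L → OnlyPreimage f M a a′ → OnlyPreimage f M b b′ →
                edgeCount (map (mapEdge f) L) a b ≡ edgeCount L a′ b′
edgeCount-map f a b a′ b′ []            []                   _     _     = refl
edgeCount-map f {M} a b a′ b′ ((x , y) ∷ L) ((x<M , y<M) ∷ below) onlyᵃ onlyᵇ = begin
  edgeCount ((f x , f y) ∷ map (mapEdge f) L) a b                    ≡⟨ edgeCount-∷ (f x , f y) _ a b ⟩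
  indicator (isEdge a b (f x , f y)) + edgeCount (map (mapEdge f) L) a b
    ≡⟨ cong₂ (λ e n → indicator e + n) isEdge-map (edgeCount-map f a b a′ b′ L below onlyᵃ onlyᵇ) ⟩
  indicator (isEdge a′ b′ (x , y)) + edgeCount L a′ b′               ≡⟨ edgeCount-∷ (x , y) L a′ b′ ⟨
  edgeCount ((x , y) ∷ L) a′ b′                                      ∎
  where
  open ≡-Reasoning
  local : ∀ {z c c′} → z < M → OnlyPreimage f M c c′ → (f z ≡ᵇ c) ≡ (z ≡ᵇ c′)
  local {z} z<M only = ≡ᵇ-cong (proj₂ (only z z<M)) (proj₁ (only z z<M))
  isEdge-map : isEdge a b (f x , f y) ≡ isEdge a′ b′ (x , y)
  isEdge-map rewrite local x<M onlyᵃ | local y<M onlyᵇ | local x<M onlyᵇ | local y<M onlyᵃ = refl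

m≤m+n∸o : ∀ m {n o} → o ≤ n → m ≤ m + n ∸ o
m≤m+n∸o m {n} {o} o≤n = ≤-trans (m≤m+n m (n ∸ o)) (≤-reflexive (sym (+-∸-assoc m o≤n)))

size≥2 : ∀ t → 2 ≤ size t
size≥2 k2        = ≤-refl
size≥2 (par s t) = ≤-trans (size≥2 s) (m≤m+n∸o (size s) (size≥2 t))
size≥2 (ser s t) = ≤-trans (size≥2 s) (m≤m+n∸o (size s) (≤-trans (s≤s z≤n) (size≥2 t)))

parShift : ℕ → ℕ → ℕ
parShift S 0 = 0
parShift S 1 = 1
parShift S v = v + S ∸ 2

serShiftˡ : ℕ → ℕ → ℕ
serShiftˡ S 0 = 0
serShiftˡ S 1 = S
serShiftˡ S v = v

serShiftʳ : ℕ → ℕ → ℕ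
serShiftʳ S 0 = S
serShiftʳ S 1 = 1
serShiftʳ S v = v + S ∸ 1

-- Local coordinates of a vertex of a composition inside one of its two parts; a vertex
-- not in that part is sent to the first index beyond its range.
parLocal : ℕ → ℕ → ℕ → ℕ
parLocal S T zero          = zero
parLocal S T (suc zero)    = suc zero
parLocal S T (suc (suc a)) = if suc (suc a) <ᵇ S then T else 2 + (suc (suc a) ∸ S)

serLocalˡ : ℕ → ℕ → ℕ
serLocalˡ S zero          = zero
serLocalˡ S (suc zero)    = S
serLocalˡ S (suc (suc a)) = if suc (suc a) ≡ᵇ S then 1 else suc (suc a)

serLocalʳ : ℕ → ℕ → ℕ → ℕ
serLocalʳ S T a = if a ≡ᵇ S then 0 else (if a ≡ᵇ 1 then 1 else (if a <ᵇ S then T else suc (a ∸ S)))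

parLocal-< : ∀ S T a → 2 ≤ a → a < S → parLocal S T a ≡ T
parLocal-< S T (suc (suc a)) (s≤s (s≤s _)) a<S rewrite <⇒<ᵇ≡true a<S = refl

parLocal-≥ : ∀ S T a → 2 ≤ a → S ≤ a → parLocal S T a ≡ 2 + (a ∸ S)
parLocal-≥ S T (suc (suc a)) (s≤s (s≤s _)) S≤a rewrite ≮⇒<ᵇ≡false (≤⇒≯ S≤a) = refl

parLocal-2 : ∀ T a → parLocal 2 T a ≡ a
parLocal-2 T 0             = refl
parLocal-2 T 1             = refl
parLocal-2 T (suc (suc a)) = refl

parLocal-parShift : ∀ {S} T → 2 ≤ S → ∀ x → parLocal S T (parShift S x) ≡ x
parLocal-parShift T 2≤S 0             = refl
parLocal-parShift T 2≤S 1             = refl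
parLocal-parShift {S} T 2≤S (suc (suc v)) = begin
  parLocal S T (v + S)        ≡⟨ parLocal-≥ S T (v + S) (≤-trans 2≤S (m≤n+m S v)) (m≤n+m S v) ⟩
  2 + (v + S ∸ S)             ≡⟨ cong (2 +_) (m+n∸n≡m v S) ⟩
  2 + v                       ∎
  where open ≡-Reasoning

parShift-parLocal : ∀ S T a → parLocal S T a < T → parShift S (parLocal S T a) ≡ a
parShift-parLocal S T 0             _ = refl
parShift-parLocal S T 1             _ = refl
parShift-parLocal S T (suc (suc a)) local<T with suc (suc a) <ᵇ S in eq
... | true  = ⊥-elim (<-irrefl refl local<T)
... | false = m∸n+n≡m (<ᵇ≡false⇒≥ (suc (suc a)) S eq)

serLocalˡ-serShiftˡ : ∀ {S} → 2 ≤ S → ∀ x → x < S → serLocalˡ S (serShiftˡ S x) ≡ x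
serLocalˡ-serShiftˡ _             0             _   = refl
serLocalˡ-serShiftˡ {S} (s≤s (s≤s _)) 1 _ rewrite ≡⇒≡ᵇ≡true {S} refl = refl
serLocalˡ-serShiftˡ _ (suc (suc v)) x<S rewrite ≢⇒≡ᵇ≡false (<⇒≢ x<S) = refl

serShiftˡ-serLocalˡ : ∀ S a → serLocalˡ S a < S → serShiftˡ S (serLocalˡ S a) ≡ a
serShiftˡ-serLocalˡ S 0             _        = refl
serShiftˡ-serLocalˡ S 1             local<S  = ⊥-elim (<-irrefl refl local<S)
serShiftˡ-serLocalˡ S (suc (suc a)) _        with suc (suc a) ≡ᵇ S in eq
... | true  = sym (≡ᵇ≡true⇒≡ (suc (suc a)) S eq)
... | false = refl

serLocalʳ-serShiftʳ : ∀ {S} T → 2 ≤ S → ∀ x → serLocalʳ S T (serShiftʳ S x) ≡ x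
serLocalʳ-serShiftʳ {S} T _ 0 rewrite ≡⇒≡ᵇ≡true {S} refl = refl
serLocalʳ-serShiftʳ T (s≤s (s≤s _)) 1 = refl
serLocalʳ-serShiftʳ {S} T 2≤S (suc (suc v))
  rewrite ≢⇒≡ᵇ≡false (>⇒≢ (s≤s (m≤n+m S v))) | ≢⇒≡ᵇ≡false {suc (v + S)} {1} (>⇒≢ (s≤s (≤-trans (≤-trans (s≤s z≤n) 2≤S) (m≤n+m S v))))
        | ≮⇒<ᵇ≡false (<⇒≯ (s≤s (m≤n+m S v))) = cong suc (m+n∸n≡m (suc v) S)

serShiftʳ-serLocalʳ : ∀ S T a → serLocalʳ S T a < T → serShiftʳ S (serLocalʳ S T a) ≡ a
serShiftʳ-serLocalʳ S T a local<T with a ≡ᵇ S in isSource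
... | true  = sym (≡ᵇ≡true⇒≡ a S isSource)
... | false with a ≡ᵇ 1 in isSink
...   | true  = sym (≡ᵇ≡true⇒≡ a 1 isSink)
...   | false with a <ᵇ S in isLeft
...     | true  = ⊥-elim (<-irrefl refl local<T)
...     | false with a ∸ S in offset
...       | zero  = ⊥-elim (true≢false (trans (sym (≡⇒≡ᵇ≡true (≤-antisym (m∸n≡0⇒m≤n offset) (<ᵇ≡false⇒≥ a S isLeft)))) isSource))
...       | suc k = trans (cong (_+ S) (sym offset)) (m∸n+n≡m (<ᵇ≡false⇒≥ a S isLeft))

par-OnlyPreimage : ∀ S T → 2 ≤ S → ∀ a → OnlyPreimage (parShift S) T a (parLocal S T a)
par-OnlyPreimage S T 2≤S a = retraction⇒OnlyPreimage (λ x _ → parLocal-parShift T 2≤S x) a (parShift-parLocal S T a)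

serˡ-OnlyPreimage : ∀ S → 2 ≤ S → ∀ a → OnlyPreimage (serShiftˡ S) S a (serLocalˡ S a)
serˡ-OnlyPreimage S 2≤S a = retraction⇒OnlyPreimage (serLocalˡ-serShiftˡ 2≤S) a (serShiftˡ-serLocalˡ S a)

serʳ-OnlyPreimage : ∀ S T → 2 ≤ S → ∀ a → OnlyPreimage (serShiftʳ S) T a (serLocalʳ S T a)
serʳ-OnlyPreimage S T 2≤S a = retraction⇒OnlyPreimage (λ x _ → serLocalʳ-serShiftʳ T 2≤S x) a (serShiftʳ-serLocalʳ S T a)

mapEdge-cong : ∀ {f g : ℕ → ℕ} → (∀ x → f x ≡ g x) → ∀ L → map (mapEdge f) L ≡ map (mapEdge g) L
mapEdge-cong f≗g = map-cong (λ { (x , y) → cong₂ _,_ (f≗g x) (f≗g y) })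

edges-par : ∀ s t → edges (par s t) ≡ edges s ++ map (mapEdge (parShift (size s))) (edges t)
edges-par s t = cong (edges s ++_) (mapEdge-cong (λ { 0 → refl ; 1 → refl ; (suc (suc v)) → refl }) (edges t))

edges-ser : ∀ s t → edges (ser s t) ≡ map (mapEdge (serShiftˡ (size s))) (edges s) ++ map (mapEdge (serShiftʳ (size s))) (edges t)
edges-ser s t = cong₂ _++_ (mapEdge-cong (λ { 0 → refl ; 1 → refl ; (suc (suc v)) → refl }) (edges s))
                            (mapEdge-cong (λ { 0 → refl ; 1 → refl ; (suc (suc v)) → refl }) (edges t))

EdgesBelow-map : ∀ {M M′} f L → (∀ x → x < M → f x < M′) → EdgesBelow M L → EdgesBelow M′ (map (mapEdge f) L)
EdgesBelow-map f L f< below = map⁺ (All.map (λ { (x<M , y<M) → f< _ x<M , f< _ y<M }) below)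

EdgesBelow-weaken : ∀ {M M′} L → M ≤ M′ → EdgesBelow M L → EdgesBelow M′ L
EdgesBelow-weaken L M≤M′ = All.map (λ { (x<M , y<M) → ≤-trans x<M M≤M′ , ≤-trans y<M M≤M′ })

private
  2+m≤m+[2+n] : ∀ m n → 2 + m ≤ m + (2 + n)
  2+m≤m+[2+n] m n = ≤-trans (m≤m+n (2 + m) n) (≤-reflexive (reorder m n))
    where
    reorder : ∀ m n → 2 + m + n ≡ m + (2 + n)
    reorder = solve-∀

  v+[2+m]<m+[2+n] : ∀ m n v → v < n → v + (2 + m) < m + (2 + n)
  v+[2+m]<m+[2+n] m n v v<n = subst₂ _<_ (left m v) (right m n) (s≤s (s≤s (+-monoʳ-< m v<n)))
    where
    left : ∀ m v → 2 + (m + v) ≡ v + (2 + m)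
    left = solve-∀
    right : ∀ m n → 2 + (m + n) ≡ m + (2 + n)
    right = solve-∀

parShift-< : ∀ {S T} → 2 ≤ S → 2 ≤ T → ∀ x → x < T → parShift S x < S + T ∸ 2
parShift-< {suc (suc S)} {suc (suc T)} (s≤s (s≤s _)) (s≤s (s≤s _)) 0             _               = <-≤-trans z<s (m≤n+m _ S)
parShift-< {suc (suc S)} {suc (suc T)} (s≤s (s≤s _)) (s≤s (s≤s _)) 1             _               = <-≤-trans (s≤s z<s) (m≤n+m _ S)
parShift-< {suc (suc S)} {suc (suc T)} (s≤s (s≤s _)) (s≤s (s≤s _)) (suc (suc v)) (s≤s (s≤s v<T)) = v+[2+m]<m+[2+n] S T v v<T

serShiftˡ-< : ∀ {S T} → 2 ≤ S → 2 ≤ T → ∀ x → x < S → serShiftˡ S x < S + T ∸ 1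
serShiftˡ-< {suc (suc S)} {suc (suc T)} (s≤s (s≤s _)) (s≤s (s≤s _)) x x<S = s≤s (≤-trans (serShiftˡ-≤ x x<S) (2+m≤m+[2+n] S T))
  where
  serShiftˡ-≤ : ∀ x → x < 2 + S → serShiftˡ (2 + S) x ≤ 2 + S
  serShiftˡ-≤ 0             _   = z≤n
  serShiftˡ-≤ 1             _   = ≤-refl
  serShiftˡ-≤ (suc (suc v)) x<S = <⇒≤ x<S

serShiftʳ-< : ∀ {S T} → 2 ≤ S → 2 ≤ T → ∀ x → x < T → serShiftʳ S x < S + T ∸ 1
serShiftʳ-< {suc (suc S)} {suc (suc T)} (s≤s (s≤s _)) (s≤s (s≤s _)) 0             _               = s≤s (2+m≤m+[2+n] S T)
serShiftʳ-< {suc (suc S)} {suc (suc T)} (s≤s (s≤s _)) (s≤s (s≤s _)) 1             _               = s≤s (≤-trans (s≤s z≤n) (m≤n+m _ S))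
serShiftʳ-< {suc (suc S)} {suc (suc T)} (s≤s (s≤s _)) (s≤s (s≤s _)) (suc (suc v)) (s≤s (s≤s v<T)) = s≤s (v+[2+m]<m+[2+n] S T v v<T)

edgesBelow : ∀ t → EdgesBelow (size t) (edges t)
edgesBelow k2        = (s≤s z≤n , s≤s (s≤s z≤n)) ∷ []
edgesBelow (par s t) rewrite edges-par s t = ++⁺
  (EdgesBelow-weaken (edges s) (m≤m+n∸o (size s) (size≥2 t)) (edgesBelow s))
  (EdgesBelow-map _ (edges t) (parShift-< (size≥2 s) (size≥2 t)) (edgesBelow t))
edgesBelow (ser s t) rewrite edges-ser s t = ++⁺
  (EdgesBelow-map _ (edges s) (serShiftˡ-< (size≥2 s) (size≥2 t)) (edgesBelow s))
  (EdgesBelow-map _ (edges t) (serShiftʳ-< (size≥2 s) (size≥2 t)) (edgesBelow t))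

multiplicity-par : ∀ s t a b → multiplicity (par s t) a b ≡
  multiplicity s a b + multiplicity t (parLocal (size s) (size t) a) (parLocal (size s) (size t) b)
multiplicity-par s t a b = begin
  edgeCount (edges (par s t)) a b
    ≡⟨ cong (λ L → edgeCount L a b) (edges-par s t) ⟩
  edgeCount (edges s ++ map (mapEdge (parShift (size s))) (edges t)) a b
    ≡⟨ edgeCount-++ (edges s) _ a b ⟩
  multiplicity s a b + edgeCount (map (mapEdge (parShift (size s))) (edges t)) a b
    ≡⟨ cong (multiplicity s a b +_) (edgeCount-map _ a b _ _ (edges t) (edgesBelow t) (only a) (only b)) ⟩
  multiplicity s a b + multiplicity t (parLocal (size s) (size t) a) (parLocal (size s) (size t) b) ∎
  where
  open ≡-Reasoning
  only : ∀ a → OnlyPreimage (parShift (size s)) (size t) a (parLocal (size s) (size t) a)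
  only = par-OnlyPreimage (size s) (size t) (size≥2 s)

multiplicity-ser : ∀ s t a b → multiplicity (ser s t) a b ≡
  multiplicity s (serLocalˡ (size s) a) (serLocalˡ (size s) b) + multiplicity t (serLocalʳ (size s) (size t) a) (serLocalʳ (size s) (size t) b)
multiplicity-ser s t a b = begin
  edgeCount (edges (ser s t)) a b
    ≡⟨ cong (λ L → edgeCount L a b) (edges-ser s t) ⟩
  edgeCount (map (mapEdge (serShiftˡ (size s))) (edges s) ++ map (mapEdge (serShiftʳ (size s))) (edges t)) a b
    ≡⟨ edgeCount-++ (map _ (edges s)) _ a b ⟩
  edgeCount (map (mapEdge (serShiftˡ (size s))) (edges s)) a b + edgeCount (map (mapEdge (serShiftʳ (size s))) (edges t)) a b
    ≡⟨ cong₂ _+_ (edgeCount-map _ a b _ _ (edges s) (edgesBelow s) (onlyˡ a) (onlyˡ b))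
                 (edgeCount-map _ a b _ _ (edges t) (edgesBelow t) (onlyʳ a) (onlyʳ b)) ⟩
  multiplicity s (serLocalˡ (size s) a) (serLocalˡ (size s) b) +
  multiplicity t (serLocalʳ (size s) (size t) a) (serLocalʳ (size s) (size t) b) ∎
  where
  open ≡-Reasoning
  onlyˡ : ∀ a → OnlyPreimage (serShiftˡ (size s)) (size s) a (serLocalˡ (size s) a)
  onlyˡ = serˡ-OnlyPreimage (size s) (size≥2 s)
  onlyʳ : ∀ a → OnlyPreimage (serShiftʳ (size s)) (size t) a (serLocalʳ (size s) (size t) a)
  onlyʳ = serʳ-OnlyPreimage (size s) (size t) (size≥2 s)

multiplicity-sym : ∀ t a b → multiplicity t a b ≡ multiplicity t b a
multiplicity-sym t = edgeCount-sym (edges t)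

multiplicity-outsideˡ : ∀ t a b → size t ≤ a → multiplicity t a b ≡ 0
multiplicity-outsideˡ t a b = edgeCount-outside a b (edges t) (edgesBelow t)

multiplicity-outsideʳ : ∀ t a b → size t ≤ b → multiplicity t a b ≡ 0
multiplicity-outsideʳ t a b size≤b = trans (multiplicity-sym t a b) (multiplicity-outsideˡ t b a size≤b)

serLocalʳ-source : ∀ {S} T → 2 ≤ S → serLocalʳ S T 0 ≡ T
serLocalʳ-source T (s≤s (s≤s _)) = refl

serLocalʳ-sink : ∀ {S} T → 2 ≤ S → serLocalʳ S T 1 ≡ 1
serLocalʳ-sink T (s≤s (s≤s _)) = refl

serLocalʳ-< : ∀ S T a → 2 ≤ a → a < S → serLocalʳ S T a ≡ T
serLocalʳ-< S T a 2≤a a<S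
  rewrite ≢⇒≡ᵇ≡false (<⇒≢ a<S) | ≢⇒≡ᵇ≡false {a} {1} (>⇒≢ 2≤a) | <⇒<ᵇ≡true a<S = refl

serLocalˡ-≢ : ∀ S a → 2 ≤ a → a ≢ S → serLocalˡ S a ≡ a
serLocalˡ-≢ S (suc (suc a)) (s≤s (s≤s _)) a≢S rewrite ≢⇒≡ᵇ≡false a≢S = refl

noLoops : ∀ t a → multiplicity t a a ≡ 0
noLoops k2        0             = refl
noLoops k2        1             = refl
noLoops k2        (suc (suc a)) = refl
noLoops (par s t) a rewrite multiplicity-par s t a a | noLoops s a | noLoops t (parLocal (size s) (size t) a) = refl
noLoops (ser s t) a rewrite multiplicity-ser s t a a | noLoops s (serLocalˡ (size s) a) | noLoops t (serLocalʳ (size s) (size t) a) = refl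

Simple : SPTerm → Set
Simple t = ∀ a b → multiplicity t a b ≤ 1

multiplicity≡1⇒< : ∀ t a b → multiplicity t a b ≡ 1 → a < size t × b < size t
multiplicity≡1⇒< t a b m≡1 =
  ≰⇒> (λ size≤a → 0≢1+n (trans (sym (multiplicity-outsideˡ t a b size≤a)) m≡1)) ,
  ≰⇒> (λ size≤b → 0≢1+n (trans (sym (multiplicity-outsideʳ t a b size≤b)) m≡1))

+-≤1 : ∀ x y → x ≤ 1 → y ≤ 1 → ¬ (x ≡ 1 × y ≡ 1) → x + y ≤ 1
+-≤1 0 y _ y≤1 _ = y≤1
+-≤1 1 0 _ _   _ = ≤-refl
+-≤1 1 1 _ _   not-both = ⊥-elim (not-both (refl , refl))
+-≤1 (suc (suc x)) y (s≤s ()) _ _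
+-≤1 (suc x) (suc (suc y)) _ (s≤s ()) _

simple-k2 : Simple k2
simple-k2 0             0             = z≤n
simple-k2 0             1             = ≤-refl
simple-k2 0             (suc (suc b)) = z≤n
simple-k2 1             0             = ≤-refl
simple-k2 1             1             = z≤n
simple-k2 1             (suc (suc b)) = z≤n
simple-k2 (suc (suc a)) 0             = z≤n
simple-k2 (suc (suc a)) 1             = z≤n
simple-k2 (suc (suc a)) (suc (suc b)) = z≤n

shared-terminal : ∀ S T a → a < S → parLocal S T a < T → a < 2 × parLocal S T a ≡ a
shared-terminal S T 0             _   _        = s≤s z≤n , refl
shared-terminal S T 1             _   _        = s≤s (s≤s z≤n) , refl
shared-terminal S T (suc (suc a)) a<S local<T rewrite parLocal-< S T (suc (suc a)) (s≤s (s≤s z≤n)) a<S =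
  ⊥-elim (<-irrefl refl local<T)

simple-par : ∀ s t → Simple s → Simple t → multiplicity s 0 1 ≡ 0 ⊎ multiplicity t 0 1 ≡ 0 → Simple (par s t)
simple-par s t simple-s simple-t one01≡0 a b rewrite multiplicity-par s t a b =
  +-≤1 _ _ (simple-s a b) (simple-t _ _) λ (sab≡1 , tab≡1) → no-common-edge sab≡1 tab≡1
  where
  not-both-01 : multiplicity s 0 1 ≡ 0 ⊎ multiplicity t 0 1 ≡ 0 → multiplicity s 0 1 ≡ 1 → multiplicity t 0 1 ≡ 1 → ⊥
  not-both-01 (inj₁ s01≡0) s01≡1 _ = 0≢1+n (trans (sym s01≡0) s01≡1)
  not-both-01 (inj₂ t01≡0) _ t01≡1 = 0≢1+n (trans (sym t01≡0) t01≡1)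
  on-terminals : ∀ a b → a < 2 → b < 2 → multiplicity s a b ≡ 1 → multiplicity t a b ≡ 1 → ⊥
  on-terminals 0 0 _ _ s00≡1 _     = 0≢1+n (trans (sym (noLoops s 0)) s00≡1)
  on-terminals 1 1 _ _ s11≡1 _     = 0≢1+n (trans (sym (noLoops s 1)) s11≡1)
  on-terminals 0 1 _ _ s01≡1 t01≡1 = not-both-01 one01≡0 s01≡1 t01≡1
  on-terminals 1 0 _ _ s10≡1 t10≡1 =
    not-both-01 one01≡0 (trans (multiplicity-sym s 0 1) s10≡1) (trans (multiplicity-sym t 0 1) t10≡1)
  on-terminals (suc (suc _)) _ (s≤s (s≤s ())) _ _ _
  on-terminals _ (suc (suc _)) _ (s≤s (s≤s ())) _ _
  no-common-edge : multiplicity s a b ≡ 1 → multiplicity t (parLocal (size s) (size t) a) (parLocal (size s) (size t) b) ≡ 1 → ⊥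
  no-common-edge sab≡1 tab≡1
    with shared-terminal (size s) (size t) a (proj₁ (multiplicity≡1⇒< s a b sab≡1)) (proj₁ (multiplicity≡1⇒< t _ _ tab≡1))
       | shared-terminal (size s) (size t) b (proj₂ (multiplicity≡1⇒< s a b sab≡1)) (proj₂ (multiplicity≡1⇒< t _ _ tab≡1))
  ... | a<2 , locala≡a | b<2 , localb≡b = on-terminals a b a<2 b<2 sab≡1 (subst₂ (λ x y → multiplicity t x y ≡ 1) locala≡a localb≡b tab≡1)

shared-junction : ∀ s t a → serLocalˡ (size s) a < size s → serLocalʳ (size s) (size t) a < size t → a ≡ size s
shared-junction s t 0 _ local<T rewrite serLocalʳ-source (size t) (size≥2 s) = ⊥-elim (<-irrefl refl local<T)
shared-junction s t 1 local<S _ = ⊥-elim (<-irrefl refl local<S)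
shared-junction s t (suc (suc a)) localˡ<S localʳ<T with suc (suc a) ≟ size s
... | yes a≡S = a≡S
... | no  a≢S with <-cmp (suc (suc a)) (size s)
...   | tri< a<S _ _ rewrite serLocalʳ-< (size s) (size t) (suc (suc a)) (s≤s (s≤s z≤n)) a<S = ⊥-elim (<-irrefl refl localʳ<T)
...   | tri≈ _ a≡S _ = ⊥-elim (a≢S a≡S)
...   | tri> _ _ S<a rewrite serLocalˡ-≢ (size s) (suc (suc a)) (s≤s (s≤s z≤n)) a≢S = ⊥-elim (<⇒≱ localˡ<S (<⇒≤ S<a))

simple-ser : ∀ s t → Simple s → Simple t → Simple (ser s t)
simple-ser s t simple-s simple-t a b rewrite multiplicity-ser s t a b =
  +-≤1 _ _ (simple-s _ _) (simple-t _ _) λ (sab≡1 , tab≡1) → 0≢1+n (trans (sym (noLoops s _)) (loop sab≡1 tab≡1))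
  where
  loop : multiplicity s (serLocalˡ (size s) a) (serLocalˡ (size s) b) ≡ 1 →
         multiplicity t (serLocalʳ (size s) (size t) a) (serLocalʳ (size s) (size t) b) ≡ 1 →
         multiplicity s (serLocalˡ (size s) (size s)) (serLocalˡ (size s) (size s)) ≡ 1
  loop sab≡1 tab≡1 = subst₂ (λ x y → multiplicity s (serLocalˡ (size s) x) (serLocalˡ (size s) y) ≡ 1)
    (shared-junction s t a (proj₁ (multiplicity≡1⇒< s _ _ sab≡1)) (proj₁ (multiplicity≡1⇒< t _ _ tab≡1)))
    (shared-junction s t b (proj₂ (multiplicity≡1⇒< s _ _ sab≡1)) (proj₂ (multiplicity≡1⇒< t _ _ tab≡1))) sab≡1

ser-source-sink : ∀ s t → multiplicity (ser s t) 0 1 ≡ 0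
ser-source-sink s t
  rewrite multiplicity-ser s t 0 1 | serLocalʳ-source (size t) (size≥2 s) | serLocalʳ-sink (size t) (size≥2 s)
        | multiplicity-outsideʳ s 0 (size s) ≤-refl | multiplicity-outsideˡ t (size t) 1 ≤-refl = refl

k2-edge : ∀ a b → multiplicity k2 a b ≡ 1 → (a ≡ 0 × b ≡ 1) ⊎ (a ≡ 1 × b ≡ 0)
k2-edge 0 1 _ = inj₁ (refl , refl)
k2-edge 1 0 _ = inj₂ (refl , refl)
k2-edge 0 0 ()
k2-edge 0 (suc (suc b)) ()
k2-edge 1 1 ()
k2-edge 1 (suc (suc b)) ()
k2-edge (suc (suc a)) b m≡1 = ⊥-elim (0≢1+n (trans (sym (multiplicity-outsideˡ k2 (suc (suc a)) b (s≤s (s≤s z≤n)))) m≡1))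

+≡1 : ∀ x y → x + y ≡ 1 → x ≡ 1 ⊎ y ≡ 1
+≡1 0 y       x+y≡1 = inj₂ x+y≡1
+≡1 1 0       _     = inj₁ refl
+≡1 1 (suc y) ()
+≡1 (suc (suc x)) y ()

-- Books, fans and blocks

path₂ : SPTerm
path₂ = ser k2 k2

-- Hub 0 and sink 1 are adjacent, and each leaf 2 + j (j < m) is adjacent to both.
book : ℕ → SPTerm
book zero    = k2
book (suc m) = par path₂ (book m)

-- Hub 0 is adjacent to the sink 1 and to every vertex of the path 2, 3, …, m + 1, 1.
fan : ℕ → SPTerm
fan zero    = k2
fan (suc m) = par k2 (ser (fan m) k2)

gadget : Bool → ℕ → SPTerm
gadget true  = book
gadget false = fan

hubNeighbour : ℕ → ℕ → Bool
hubNeighbour m 0             = false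
hubNeighbour m 1             = true
hubNeighbour m (suc (suc j)) = j <ᵇ m

size-book : ∀ m → size (book m) ≡ 2 + m
size-book zero    = refl
size-book (suc m) = cong suc (size-book m)

size-fan : ∀ m → size (fan m) ≡ 2 + m
size-fan zero    = refl
size-fan (suc m) rewrite size-fan m = cong suc (+-comm m 2)

simple-book : ∀ m → Simple (book m)
simple-book zero    = simple-k2
simple-book (suc m) = simple-par path₂ (book m) (simple-ser k2 k2 simple-k2 simple-k2) (simple-book m) (inj₁ (ser-source-sink k2 k2))

simple-fan : ∀ m → Simple (fan m)
simple-fan zero    = simple-k2
simple-fan (suc m) = simple-par k2 (ser (fan m) k2) simple-k2 (simple-ser (fan m) k2 (simple-fan m) simple-k2) (inj₂ (ser-source-sink (fan m) k2))

book-hub : ∀ m w → multiplicity (book m) 0 w ≡ indicator (hubNeighbour m w)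
book-hub zero    0             = refl
book-hub zero    1             = refl
book-hub zero    (suc (suc j)) = refl
book-hub (suc m) w rewrite multiplicity-par path₂ (book m) 0 w = row w
  where
  row : ∀ w → multiplicity path₂ 0 w + multiplicity (book m) 0 (parLocal 3 (size (book m)) w) ≡ indicator (hubNeighbour (suc m) w)
  row 0                   = book-hub m 0
  row 1                   = book-hub m 1
  row 2                   = cong suc (multiplicity-outsideʳ (book m) 0 (size (book m)) ≤-refl)
  row (suc (suc (suc j))) = book-hub m (suc (suc j))

book-leaf-sink : ∀ m j → j < m → multiplicity (book m) 1 (2 + j) ≡ 1
book-leaf-sink (suc m) zero    _ rewrite multiplicity-par path₂ (book m) 1 2 =
  cong suc (multiplicity-outsideʳ (book m) 1 (size (book m)) ≤-refl)
book-leaf-sink (suc m) (suc j) (s≤s j<m) rewrite multiplicity-par path₂ (book m) 1 (3 + j) = book-leaf-sink m j j<m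

fan-suc : ∀ m a b → multiplicity (fan (suc m)) a b ≡ multiplicity k2 a b +
  (multiplicity (fan m) (serLocalˡ (2 + m) a) (serLocalˡ (2 + m) b) + multiplicity k2 (serLocalʳ (2 + m) 2 a) (serLocalʳ (2 + m) 2 b))
fan-suc m a b rewrite multiplicity-par k2 (ser (fan m) k2) a b | parLocal-2 (size (ser (fan m) k2)) a | parLocal-2 (size (ser (fan m) k2)) b
  | multiplicity-ser (fan m) k2 a b | size-fan m = refl

fan-hub : ∀ m w → multiplicity (fan m) 0 w ≡ indicator (hubNeighbour m w)
fan-hub zero    0             = refl
fan-hub zero    1             = refl
fan-hub zero    (suc (suc j)) = refl
fan-hub (suc m) w rewrite fan-suc m 0 w | multiplicity-outsideˡ k2 2 (serLocalʳ (2 + m) 2 w) ≤-refl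
  | +-identityʳ (multiplicity (fan m) 0 (serLocalˡ (2 + m) w)) = row w
  where
  row : ∀ w → multiplicity k2 0 w + multiplicity (fan m) 0 (serLocalˡ (2 + m) w) ≡ indicator (hubNeighbour (suc m) w)
  row 0 = fan-hub m 0
  row 1 rewrite multiplicity-outsideʳ (fan m) 0 (2 + m) (≤-reflexive (size-fan m)) = refl
  row (suc (suc j)) with <-cmp j m
  ... | tri< j<m _ _ rewrite ≢⇒≡ᵇ≡false (<⇒≢ j<m) | fan-hub m (suc (suc j)) | <⇒<ᵇ≡true j<m | <⇒<ᵇ≡true (m<n⇒m<1+n j<m) = refl
  ... | tri≈ _ refl _ rewrite ≡⇒≡ᵇ≡true {j} refl | fan-hub m 1 | <⇒<ᵇ≡true (n<1+n j) = refl
  ... | tri> _ _ m<j rewrite ≢⇒≡ᵇ≡false (>⇒≢ m<j) | fan-hub m (suc (suc j)) | ≮⇒<ᵇ≡false (<⇒≯ m<j) | ≮⇒<ᵇ≡false (≤⇒≯ m<j) = refl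

-- The possible neighbours of leaf j of a fan with m leaves, hub h and leaves leaf 0, leaf 1, ….
data FanNeighbour (h : ℕ) (leaf : ℕ → ℕ) (m j : ℕ) : ℕ → Set where
  hubⁿ  : FanNeighbour h leaf m j h
  prevⁿ : ∀ {k} → j ≡ suc k → FanNeighbour h leaf m j (leaf k)
  nextⁿ : FanNeighbour h leaf m j (leaf (suc j))
  sinkⁿ : suc j ≡ m → FanNeighbour h leaf m j 1

FanNeighbour-relabel : ∀ {h leaf h′ leaf′ m j v} (f : ℕ → ℕ) → f h ≡ h′ → (∀ k → f (leaf k) ≡ leaf′ k) → f 1 ≡ 1 →
                       FanNeighbour h leaf m j v → FanNeighbour h′ leaf′ m j (f v)
FanNeighbour-relabel {h′ = h′} {leaf′} {m} {j} f f-hub f-leaf f-sink hubⁿ = subst (FanNeighbour h′ leaf′ m j) (sym f-hub) hubⁿ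
FanNeighbour-relabel {h′ = h′} {leaf′} {m} {j} f f-hub f-leaf f-sink (prevⁿ {k} j≡1+k) =
  subst (FanNeighbour h′ leaf′ m j) (sym (f-leaf k)) (prevⁿ j≡1+k)
FanNeighbour-relabel {h′ = h′} {leaf′} {m} {j} f f-hub f-leaf f-sink nextⁿ = subst (FanNeighbour h′ leaf′ m j) (sym (f-leaf (suc j))) nextⁿ
FanNeighbour-relabel {h′ = h′} {leaf′} {m} {j} f f-hub f-leaf f-sink (sinkⁿ 1+j≡m) = subst (FanNeighbour h′ leaf′ m j) (sym f-sink) (sinkⁿ 1+j≡m)

fan-sink-neighbour : ∀ m v → multiplicity (fan m) 1 v ≡ 1 → v ≡ 0 ⊎ Σ ℕ λ k → m ≡ suc k × v ≡ 2 + k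
fan-sink-neighbour zero v m≡1 with k2-edge 1 v m≡1
... | inj₂ (_ , v≡0) = inj₁ v≡0
fan-sink-neighbour (suc m) v m≡1
  rewrite fan-suc m 1 v | multiplicity-outsideˡ (fan m) (2 + m) (serLocalˡ (2 + m) v) (≤-reflexive (size-fan m))
  with +≡1 _ _ m≡1
... | inj₁ k2≡1 with k2-edge 1 v k2≡1
...   | inj₂ (_ , v≡0) = inj₁ v≡0
fan-sink-neighbour (suc m) v m≡1 | inj₂ k2≡1 with k2-edge 1 (serLocalʳ (2 + m) 2 v) k2≡1
...   | inj₂ (_ , u≡0) = inj₂ (m , refl , sym (trans (cong (serShiftʳ (2 + m)) (sym u≡0)) (serShiftʳ-serLocalʳ (2 + m) 2 v local<2)))
  where
  local<2 : serLocalʳ (2 + m) 2 v < 2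
  local<2 = proj₂ (multiplicity≡1⇒< k2 1 (serLocalʳ (2 + m) 2 v) k2≡1)

-- The leaves of fan (suc m) are those of fan m and the former sink of fan m, now leaf m.
fan-neighbour : ∀ m j w → j < m → multiplicity (fan m) (2 + j) w ≡ 1 → FanNeighbour 0 (2 +_) m j w
fan-neighbour (suc m) j w (s≤s j≤m) m≡1 with m≤n⇒m<n∨m≡n j≤m
... | inj₁ j<m
  rewrite fan-suc m (2 + j) w | ≢⇒≡ᵇ≡false (<⇒≢ j<m) | <⇒<ᵇ≡true j<m
        | multiplicity-outsideˡ k2 (2 + j) w (s≤s (s≤s z≤n)) | multiplicity-outsideˡ k2 2 (serLocalʳ (2 + m) 2 w) ≤-refl
        | +-identityʳ (multiplicity (fan m) (2 + j) (serLocalˡ (2 + m) w))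
  = subst (FanNeighbour 0 (2 +_) (suc m) j) w≡ (relabel (fan-neighbour m j _ j<m m≡1))
  where
  w≡ : serShiftˡ (2 + m) (serLocalˡ (2 + m) w) ≡ w
  w≡ = serShiftˡ-serLocalˡ (2 + m) w (subst (serLocalˡ (2 + m) w <_) (size-fan m) (proj₂ (multiplicity≡1⇒< (fan m) _ _ m≡1)))
  relabel : ∀ {v} → FanNeighbour 0 (2 +_) m j v → FanNeighbour 0 (2 +_) (suc m) j (serShiftˡ (2 + m) v)
  relabel hubⁿ              = hubⁿ
  relabel (prevⁿ j≡1+k)     = prevⁿ j≡1+k
  relabel nextⁿ             = nextⁿ
  relabel (sinkⁿ refl)      = nextⁿ
... | inj₂ refl
  rewrite fan-suc j (2 + j) w | ≡⇒≡ᵇ≡true {j} refl | multiplicity-outsideˡ k2 (2 + j) w (s≤s (s≤s z≤n))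
  with +≡1 _ _ m≡1
...   | inj₁ sink≡1 = subst (FanNeighbour 0 (2 +_) (suc j) j) w≡ (relabel (fan-sink-neighbour j _ sink≡1))
  where
  w≡ : serShiftˡ (2 + j) (serLocalˡ (2 + j) w) ≡ w
  w≡ = serShiftˡ-serLocalˡ (2 + j) w (subst (serLocalˡ (2 + j) w <_) (size-fan j) (proj₂ (multiplicity≡1⇒< (fan j) _ _ sink≡1)))
  relabel : ∀ {v} → v ≡ 0 ⊎ Σ ℕ (λ k → j ≡ suc k × v ≡ 2 + k) → FanNeighbour 0 (2 +_) (suc j) j (serShiftˡ (2 + j) v)
  relabel (inj₁ refl)                = hubⁿ
  relabel (inj₂ (k , j≡1+k , refl))  = prevⁿ j≡1+k
...   | inj₂ k2≡1 with k2-edge 0 (serLocalʳ (2 + j) 2 w) k2≡1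
...     | inj₁ (_ , u≡1) = subst (FanNeighbour 0 (2 +_) (suc j) j) w≡1 (sinkⁿ refl)
  where
  w≡1 : 1 ≡ w
  w≡1 = trans (cong (serShiftʳ (2 + j)) (sym u≡1)) (serShiftʳ-serLocalʳ (2 + j) 2 w (proj₂ (multiplicity≡1⇒< k2 0 _ k2≡1)))

size-gadget : ∀ b m → size (gadget b m) ≡ 2 + m
size-gadget true  = size-book
size-gadget false = size-fan

simple-gadget : ∀ b m → Simple (gadget b m)
simple-gadget true  = simple-book
simple-gadget false = simple-fan

gadget-hub : ∀ b m w → multiplicity (gadget b m) 0 w ≡ indicator (hubNeighbour m w)
gadget-hub true  = book-hub
gadget-hub false = fan-hub

-- Source 0 and sink 1; the gadget hangs between the hub 2 and the sink, its leaves
-- becoming the vertices 3 + j.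
block : ℕ → Bool → SPTerm
block d b = ser k2 (gadget b d)

size-block : ∀ d b → size (block d b) ≡ 3 + d
size-block d b = cong suc (size-gadget b d)

simple-block : ∀ d b → Simple (block d b)
simple-block d b = simple-ser k2 (gadget b d) simple-k2 (simple-gadget b d)

block-source-row : ∀ d b w → multiplicity (block d b) 0 w ≡ multiplicity k2 0 (serLocalˡ 2 w)
block-source-row d b w rewrite multiplicity-ser k2 (gadget b d) 0 w
  | multiplicity-outsideˡ (gadget b d) (size (gadget b d)) (serLocalʳ 2 (size (gadget b d)) w) ≤-refl = +-identityʳ _

block-hub-row : ∀ d b w →
  multiplicity (block d b) 2 w ≡ multiplicity k2 1 (serLocalˡ 2 w) + indicator (hubNeighbour d (serLocalʳ 2 (2 + d) w))
block-hub-row d b w rewrite multiplicity-ser k2 (gadget b d) 2 w | gadget-hub b d (serLocalʳ 2 (size (gadget b d)) w)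
  | size-gadget b d = refl

block-hub-source : ∀ d b → multiplicity (block d b) 2 0 ≡ 1
block-hub-source d b rewrite block-hub-row d b 0 | ≮⇒<ᵇ≡false (n≮n d) = refl

block-hub-sink : ∀ d b → multiplicity (block d b) 2 1 ≡ 1
block-hub-sink d b rewrite block-hub-row d b 1 = refl

block-hub-leaf : ∀ d b j → j < d → multiplicity (block d b) 2 (3 + j) ≡ 1
block-hub-leaf d b j j<d rewrite block-hub-row d b (3 + j) | <⇒<ᵇ≡true j<d = refl

block-leaf-sink : ∀ d j → j < d → multiplicity (block d true) (3 + j) 1 ≡ 1
block-leaf-sink d j j<d rewrite multiplicity-ser k2 (book d) (3 + j) 1 | multiplicity-sym (book d) (2 + j) 1 = book-leaf-sink d j j<d

block-leaf-neighbour : ∀ d j w → j < d → multiplicity (block d false) (3 + j) w ≡ 1 → FanNeighbour 2 (3 +_) d j w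
block-leaf-neighbour d j w j<d m≡1
  rewrite multiplicity-ser k2 (fan d) (3 + j) w | multiplicity-outsideˡ k2 (3 + j) (serLocalˡ 2 w) (s≤s (s≤s z≤n))
  = subst (FanNeighbour 2 (3 +_) d j) w≡
          (FanNeighbour-relabel (serShiftʳ 2) refl (λ k → cong suc (+-comm k 2)) refl (fan-neighbour d j _ j<d m≡1))
  where
  w≡ : serShiftʳ 2 (serLocalʳ 2 (size (fan d)) w) ≡ w
  w≡ = serShiftʳ-serLocalʳ 2 (size (fan d)) w (proj₂ (multiplicity≡1⇒< (fan d) _ _ m≡1))

block-source-hub-rows : ∀ d b b′ a w → a ≡ 0 ⊎ a ≡ 2 → multiplicity (block d b) a w ≡ multiplicity (block d b′) a w
block-source-hub-rows d b b′ .0 w (inj₁ refl) = trans (block-source-row d b w) (sym (block-source-row d b′ w))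
block-source-hub-rows d b b′ .2 w (inj₂ refl) = trans (block-hub-row d b w) (sym (block-hub-row d b′ w))

parShift-≥2 : ∀ S k → parShift S (2 + k) ≡ S + k
parShift-≥2 S k = +-comm k S

module Chain (d : ℕ) where

  -- Block i occupies the vertices hub i ≤ v < hub (suc i): its hub and then its leaves.
  hub : ℕ → ℕ
  hub zero    = 2
  hub (suc i) = suc (d + hub i)

  chain : (ℕ → Bool) → ℕ → SPTerm
  chain f zero    = block d (f 0)
  chain f (suc m) = par (chain f m) (block d (f (suc m)))

  hub≥2 : ∀ i → 2 ≤ hub i
  hub≥2 zero    = ≤-refl
  hub≥2 (suc i) = ≤-trans (hub≥2 i) (≤-trans (m≤n+m (hub i) d) (n≤1+n _))

  hub<hub-suc : ∀ i → hub i < hub (suc i)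
  hub<hub-suc i = s≤s (m≤n+m (hub i) d)

  hub-mono : ∀ {i j} → i ≤ j → hub i ≤ hub j
  hub-mono {zero}  {zero}  z≤n       = ≤-refl
  hub-mono {zero}  {suc j} z≤n       = ≤-trans (hub-mono {zero} {j} z≤n) (<⇒≤ (hub<hub-suc j))
  hub-mono {suc i} {suc j} (s≤s i≤j) = s≤s (+-monoʳ-≤ d (hub-mono i≤j))

  leaf<hub-suc : ∀ i j → j < d → hub i + suc j < hub (suc i)
  leaf<hub-suc i j j<d = s≤s (subst (_≤ d + hub i) (+-comm (suc j) (hub i)) (+-monoˡ-≤ (hub i) j<d))

  size-chain : ∀ f m → size (chain f m) ≡ hub (suc m)
  size-chain f zero    = cong suc (trans (size-gadget (f 0) d) (+-comm 2 d))
  size-chain f (suc m) rewrite size-chain f m | size-block d (f (suc m)) = begin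
    hub (suc m) + (3 + d) ∸ 2   ≡⟨ +-∸-assoc (hub (suc m)) {3 + d} {2} (s≤s (s≤s z≤n)) ⟩
    hub (suc m) + suc d         ≡⟨ +-suc (hub (suc m)) d ⟩
    suc (hub (suc m) + d)       ≡⟨ cong suc (+-comm (hub (suc m)) d) ⟩
    hub (suc (suc m))           ∎
    where open ≡-Reasoning

  simple-chain : ∀ f m → Simple (chain f m)
  simple-chain f zero    = simple-block d (f 0)
  simple-chain f (suc m) = simple-par (chain f m) (block d (f (suc m))) (simple-chain f m) (simple-block d (f (suc m)))
                                      (inj₂ (ser-source-sink k2 (gadget (f (suc m)) d)))

  chain-suc : ∀ f m a b → multiplicity (chain f (suc m)) a b ≡ multiplicity (chain f m) a b +
    multiplicity (block d (f (suc m))) (parLocal (hub (suc m)) (3 + d) a) (parLocal (hub (suc m)) (3 + d) b)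
  chain-suc f m a b rewrite multiplicity-par (chain f m) (block d (f (suc m))) a b | size-chain f m | size-block d (f (suc m)) = refl

  block-outside : ∀ b S a c → 2 ≤ a → a < S → multiplicity (block d b) (parLocal S (3 + d) a) c ≡ 0
  block-outside b S a c 2≤a a<S rewrite parLocal-< S (3 + d) a 2≤a a<S =
    multiplicity-outsideˡ (block d b) (3 + d) c (≤-reflexive (size-block d b))

  chain-block : ∀ f m i a b → i ≤ m → hub i ≤ a → a < hub (suc i) →
    multiplicity (chain f m) a b ≡ multiplicity (block d (f i)) (parLocal (hub i) (3 + d) a) (parLocal (hub i) (3 + d) b)
  chain-block f zero    zero a b _ _ _ rewrite parLocal-2 (3 + d) a | parLocal-2 (3 + d) b = refl
  chain-block f (suc m) i a b i≤1+m hub≤a a<hub rewrite chain-suc f m a b with m≤n⇒m<n∨m≡n i≤1+m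
  ... | inj₂ refl rewrite multiplicity-outsideˡ (chain f m) a b (subst (_≤ a) (sym (size-chain f m)) hub≤a) = refl
  ... | inj₁ (s≤s i≤m)
    rewrite block-outside (f (suc m)) (hub (suc m)) a (parLocal (hub (suc m)) (3 + d) b)
                          (≤-trans (hub≥2 i) hub≤a) (<-≤-trans a<hub (hub-mono (s≤s i≤m)))
          | +-identityʳ (multiplicity (chain f m) a b) = chain-block f m i a b i≤m hub≤a a<hub

  parLocal-hub : ∀ i → parLocal (hub i) (3 + d) (hub i) ≡ 2
  parLocal-hub i rewrite parLocal-≥ (hub i) (3 + d) (hub i) (hub≥2 i) ≤-refl | n∸n≡0 (hub i) = refl

  parLocal-leaf : ∀ i j → parLocal (hub i) (3 + d) (hub i + suc j) ≡ 3 + j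
  parLocal-leaf i j rewrite parLocal-≥ (hub i) (3 + d) (hub i + suc j) (≤-trans (hub≥2 i) (m≤m+n _ _)) (m≤m+n _ _)
                          | m+n∸m≡n (hub i) (suc j) = refl

  data Vertex (r : ℕ) : ℕ → Set where
    source : Vertex r 0
    sink   : Vertex r 1
    hubᵛ   : ∀ i → i ≤ r → Vertex r (hub i)
    leaf   : ∀ i j → i ≤ r → j < d → Vertex r (hub i + suc j)

  vertex-view : ∀ r a → a < hub (suc r) → Vertex r a
  vertex-view r 0             _ = source
  vertex-view r 1             _ = sink
  vertex-view r (suc (suc a)) a<hub = inBlock r (s≤s (s≤s z≤n)) a<hub
    where
    inBlock : ∀ {a} r → 2 ≤ a → a < hub (suc r) → Vertex r a
    inBlock {a} r 2≤a a<hub with a <? hub r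
    inBlock {a} zero    2≤a a<hub | yes a<2 = ⊥-elim (<⇒≱ a<2 2≤a)
    inBlock {a} (suc r) 2≤a a<hub | yes a<hub-r with inBlock r 2≤a a<hub-r
    ... | source          = source
    ... | sink            = sink
    ... | hubᵛ i i≤r      = hubᵛ i (m≤n⇒m≤1+n i≤r)
    ... | leaf i j i≤r j<d = leaf i j (m≤n⇒m≤1+n i≤r) j<d
    inBlock {a} r 2≤a a<hub | no a≮hub-r with a ∸ hub r in offset
    ... | zero  = subst (Vertex r) (trans (sym (+-identityʳ (hub r))) a≡) (hubᵛ r ≤-refl)
      where
      a≡ : hub r + 0 ≡ a
      a≡ = trans (cong (hub r +_) (sym offset)) (m+[n∸m]≡n (≮⇒≥ a≮hub-r))
    ... | suc j = subst (Vertex r) a≡ (leaf r j ≤-refl j<d)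
      where
      a≡ : hub r + suc j ≡ a
      a≡ = trans (cong (hub r +_) (sym offset)) (m+[n∸m]≡n (≮⇒≥ a≮hub-r))
      j<d : j < d
      j<d = +-cancelˡ-≤ (hub r) (suc j) d (subst₂ _≤_ (sym a≡) (+-comm d (hub r)) (≤-pred a<hub))

  module _ (f : ℕ → Bool) (r : ℕ) where

    hub-source : ∀ i → i ≤ r → multiplicity (chain f r) (hub i) 0 ≡ 1
    hub-source i i≤r rewrite chain-block f r i (hub i) 0 i≤r ≤-refl (hub<hub-suc i) | parLocal-hub i = block-hub-source d (f i)

    leaf-hub : ∀ i j → i ≤ r → j < d → multiplicity (chain f r) (hub i + suc j) (hub i) ≡ 1
    leaf-hub i j i≤r j<d
      rewrite chain-block f r i (hub i + suc j) (hub i) i≤r (m≤m+n _ _) (leaf<hub-suc i j j<d)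
            | parLocal-hub i | parLocal-leaf i j | multiplicity-sym (block d (f i)) (3 + j) 2 = block-hub-leaf d (f i) j j<d

    sink-hub₀ : multiplicity (chain f r) 1 (hub 0) ≡ 1
    sink-hub₀ rewrite multiplicity-sym (chain f r) 1 2 | chain-block f r 0 2 1 z≤n ≤-refl (hub<hub-suc 0) = block-hub-sink d (f 0)

    leaf-sink : ∀ i j → i ≤ r → f i ≡ true → j < d → multiplicity (chain f r) (hub i + suc j) 1 ≡ 1
    leaf-sink i j i≤r fi≡true j<d
      rewrite chain-block f r i (hub i + suc j) 1 i≤r (m≤m+n _ _) (leaf<hub-suc i j j<d) | parLocal-leaf i j | fi≡true =
      block-leaf-sink d j j<d

    leaf-neighbour : ∀ i j w → i ≤ r → f i ≡ false → j < d → multiplicity (chain f r) (hub i + suc j) w ≡ 1 →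
                     FanNeighbour (hub i) (λ k → hub i + suc k) d j w
    leaf-neighbour i j w i≤r fi≡false j<d m≡1 =
      subst (FanNeighbour (hub i) (λ k → hub i + suc k) d j) w≡
            (FanNeighbour-relabel (parShift (hub i)) (trans (parShift-≥2 (hub i) 0) (+-identityʳ (hub i)))
                                  (λ k → parShift-≥2 (hub i) (suc k)) refl (block-leaf-neighbour d j u j<d block≡1))
      where
      u : ℕ
      u = parLocal (hub i) (3 + d) w
      block≡1 : multiplicity (block d false) (3 + j) u ≡ 1
      block≡1 = begin
        multiplicity (block d false) (3 + j) u                                      ≡⟨ cong (λ b → multiplicity (block d b) (3 + j) u) fi≡false ⟨
        multiplicity (block d (f i)) (3 + j) u                                      ≡⟨ cong (λ a → multiplicity (block d (f i)) a u) (parLocal-leaf i j) ⟨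
        multiplicity (block d (f i)) (parLocal (hub i) (3 + d) (hub i + suc j)) u   ≡⟨ chain-block f r i (hub i + suc j) w i≤r (m≤m+n _ _) (leaf<hub-suc i j j<d) ⟨
        multiplicity (chain f r) (hub i + suc j) w                                  ≡⟨ m≡1 ⟩
        1                                                                           ∎
        where open ≡-Reasoning
      w≡ : parShift (hub i) u ≡ w
      w≡ = parShift-parLocal (hub i) (3 + d) w (subst (u <_) (size-block d false) (proj₂ (multiplicity≡1⇒< (block d false) (3 + j) u block≡1)))

  -- The vertices revealed no later than the hub of block i.
  Allowed : ℕ → ℕ → Set
  Allowed i v = v ≡ 0 ⊎ (2 ≤ v × v ≤ hub i)

  block-row-agree : ∀ b b′ i k v w → i ≤ k → Allowed i v →
    multiplicity (block d b) (parLocal (hub k) (3 + d) v) w ≡ multiplicity (block d b′) (parLocal (hub k) (3 + d) v) w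
  block-row-agree b b′ i k .0 w i≤k (inj₁ refl) = block-source-hub-rows d b b′ 0 w (inj₁ refl)
  block-row-agree b b′ i k v  w i≤k (inj₂ (2≤v , v≤hub)) with m≤n⇒m<n∨m≡n (≤-trans v≤hub (hub-mono i≤k))
  ... | inj₁ v<hub rewrite block-outside b (hub k) v w 2≤v v<hub | block-outside b′ (hub k) v w 2≤v v<hub = refl
  ... | inj₂ refl  rewrite parLocal-hub k = block-source-hub-rows d b b′ 2 w (inj₂ refl)

  chain-agree : ∀ f g i m → (∀ j → j < i → f j ≡ g j) → ∀ v w → Allowed i v →
                multiplicity (chain f m) v w ≡ multiplicity (chain g m) v w
  chain-agree f g i zero f≡g v w allowed with 0 <? i
  ... | yes 0<i rewrite f≡g 0 0<i = refl
  ... | no  0≮i = subst₂ (λ x y → multiplicity (block d (f 0)) x y ≡ multiplicity (block d (g 0)) x y)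
                         (parLocal-2 (3 + d) v) (parLocal-2 (3 + d) w)
                         (block-row-agree (f 0) (g 0) i 0 v _ (≮⇒≥ 0≮i) allowed)
  chain-agree f g i (suc m) f≡g v w allowed rewrite chain-suc f m v w | chain-suc g m v w with suc m <? i
  ... | yes 1+m<i rewrite f≡g (suc m) 1+m<i = cong (_+ _) (chain-agree f g i m f≡g v w allowed)
  ... | no  1+m≮i = cong₂ _+_ (chain-agree f g i m f≡g v w allowed)
                              (block-row-agree (f (suc m)) (g (suc m)) i (suc m) v _ (≮⇒≥ 1+m≮i) allowed)

-- The adversary's inputs

permutation-ℕ : ∀ N (σ τ : ℕ → ℕ) → (∀ p → p < N → σ p < N) → (∀ v → v < N → τ v < N) →
                (∀ v → v < N → σ (τ v) ≡ v) → (∀ p → p < N → τ (σ p) ≡ p) → Permutation′ N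
permutation-ℕ N σ τ σ< τ< στ τσ = permutation to from to∘from from∘to
  where
  to : Fin N → Fin N
  to x = fromℕ< (σ< (toℕ x) (toℕ<n x))
  from : Fin N → Fin N
  from y = fromℕ< (τ< (toℕ y) (toℕ<n y))
  to∘from : ∀ y → to (from y) ≡ y
  to∘from y = toℕ-injective (trans (toℕ-fromℕ< _) (trans (cong σ (toℕ-fromℕ< _)) (στ (toℕ y) (toℕ<n y))))
  from∘to : ∀ x → from (to x) ≡ x
  from∘to x = toℕ-injective (trans (toℕ-fromℕ< _) (trans (cong τ (toℕ-fromℕ< _)) (τσ (toℕ x) (toℕ<n x))))

module _ {n : ℕ} (adj : Fin n → Fin n → Bool) where

  PathIn-snoc : ∀ {S u x w} → PathIn adj S u x → adj x w ≡ true → S w → PathIn adj S u w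
  PathIn-snoc here           x~w Sw = step x~w Sw here
  PathIn-snoc (step e Sx p)  x~w Sw = step e Sx (PathIn-snoc p x~w Sw)

  PathIn-++ : ∀ {S u x w} → PathIn adj S u x → PathIn adj S x w → PathIn adj S u w
  PathIn-++ here          q = q
  PathIn-++ (step e Sx p) q = step e Sx (PathIn-++ p q)

  -- Following parents, every vertex of a prefix reaches the root inside that prefix.
  prefixes-connected : (∀ u v → adj u v ≡ adj v u) → (pos : Fin n → ℕ) (root : Fin n) →
    (∀ v → v ≢ root → Σ (Fin n) λ p → adj v p ≡ true × pos p < pos v) →
    ∀ k → InducedConnected adj (λ v → pos v ≤ k)
  prefixes-connected adj-sym pos root parent k u w u≤k w≤k =
    PathIn-++ (toRoot (suc (pos u)) u ≤-refl u≤k) (fromRoot (suc (pos w)) w ≤-refl w≤k)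
    where
    toRoot : ∀ fuel u → pos u < fuel → pos u ≤ k → PathIn adj (λ v → pos v ≤ k) u root
    toRoot (suc fuel) u u<fuel u≤k with u Fin.≟ root
    ... | yes refl = here
    ... | no  u≢root with parent u u≢root
    ...   | p , u~p , p<u = step u~p p≤k (toRoot fuel p (<-≤-trans p<u (≤-pred u<fuel)) p≤k)
      where
      p≤k : pos p ≤ k
      p≤k = ≤-trans (<⇒≤ p<u) u≤k
    fromRoot : ∀ fuel w → pos w < fuel → pos w ≤ k → PathIn adj (λ v → pos v ≤ k) root w
    fromRoot (suc fuel) w w<fuel w≤k with w Fin.≟ root
    ... | yes refl = here
    ... | no  w≢root with parent w w≢root
    ...   | p , w~p , p<w = PathIn-snoc (fromRoot fuel p (<-≤-trans p<w (≤-pred w<fuel)) (≤-trans (<⇒≤ p<w) w≤k))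
                                        (trans (adj-sym p w) w~p) w≤k

-- The source first, then the vertices 2, 3, …, N - 1 in increasing order, and the sink 1 last.
revealedAt : ℕ → ℕ → ℕ
revealedAt N zero    = zero
revealedAt N (suc p) = if suc (suc p) ≡ᵇ N then 1 else suc (suc p)

positionOf : ℕ → ℕ → ℕ
positionOf N zero          = zero
positionOf N (suc zero)    = N ∸ 1
positionOf N (suc (suc v)) = suc v

private
  revealedAt< : ∀ N → 3 ≤ N → ∀ p → p < N → revealedAt N p < N
  revealedAt< N 3≤N zero    p<N = p<N
  revealedAt< N 3≤N (suc p) p<N with suc (suc p) ≡ᵇ N in eq
  ... | true  = <-≤-trans (s≤s (s≤s z≤n)) 3≤N
  ... | false = ≤∧≢⇒< p<N (λ 2+p≡N → true≢false (trans (sym (≡⇒≡ᵇ≡true 2+p≡N)) eq))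

  positionOf< : ∀ N → ∀ v → v < N → positionOf N v < N
  positionOf< N                 zero          v<N       = v<N
  positionOf< (suc (suc N))     (suc zero)    _         = ≤-refl
  positionOf< (suc zero)        (suc zero)    (s≤s ())
  positionOf< N                 (suc (suc v)) v<N       = <-trans (n<1+n _) v<N

  revealed∘position : ∀ N → 3 ≤ N → ∀ v → v < N → revealedAt N (positionOf N v) ≡ v
  revealed∘position N                 _             zero          _   = refl
  revealed∘position (suc (suc (suc N))) (s≤s (s≤s (s≤s _))) (suc zero) _ rewrite ≡⇒≡ᵇ≡true {N} refl = refl
  revealed∘position (suc zero) (s≤s ()) (suc zero) _
  revealed∘position (suc (suc zero)) (s≤s (s≤s ())) (suc zero) _
  revealed∘position N                 _             (suc (suc v)) v<N rewrite ≢⇒≡ᵇ≡false (<⇒≢ v<N) = refl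

  position∘revealed : ∀ N → ∀ p → p < N → positionOf N (revealedAt N p) ≡ p
  position∘revealed N zero    _ = refl
  position∘revealed N (suc p) _ with suc (suc p) ≡ᵇ N in eq
  ... | true  = cong (_∸ 1) (sym (≡ᵇ≡true⇒≡ (suc (suc p)) N eq))
  ... | false = refl

revelation-order : ∀ N → 3 ≤ N → Permutation′ N
revelation-order N 3≤N = permutation-ℕ N (revealedAt N) (positionOf N)
  (revealedAt< N 3≤N) (positionOf< N) (revealed∘position N 3≤N) (position∘revealed N)

revealedAt-≢ : ∀ N k → 2 + k ≢ N → revealedAt N (suc k) ≡ 2 + k
revealedAt-≢ N k 2+k≢N rewrite ≢⇒≡ᵇ≡false 2+k≢N = refl

≤1⇒≡indicator : ∀ m → m ≤ 1 → m ≡ (if 0 <ᵇ m then 1 else 0)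
≤1⇒≡indicator zero          _        = refl
≤1⇒≡indicator (suc zero)    _        = refl
≤1⇒≡indicator (suc (suc m)) (s≤s ())

≡1⇒0<ᵇ : ∀ {m} → m ≡ 1 → (0 <ᵇ m) ≡ true
≡1⇒0<ᵇ refl = refl

positionOf-≥2 : ∀ N a → 2 ≤ a → positionOf N a ≡ a ∸ 1
positionOf-≥2 N (suc (suc a)) (s≤s (s≤s _)) = refl

module Construction (d r : ℕ) where
  open Chain d public

  N : ℕ
  N = hub (suc r)

  3≤N : 3 ≤ N
  3≤N = s≤s (≤-trans (hub≥2 r) (m≤n+m _ d))

  hub<N : ∀ i → i ≤ r → hub i < N
  hub<N i i≤r = <-≤-trans (hub<hub-suc i) (hub-mono (s≤s i≤r))

  leaf<N : ∀ i j → i ≤ r → j < d → hub i + suc j < N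
  leaf<N i j i≤r j<d = <-≤-trans (leaf<hub-suc i j j<d) (hub-mono (s≤s i≤r))

  graph : (ℕ → Bool) → Graph
  graph f = record
    { n      = N
    ; adj    = λ u v → 0 <ᵇ multiplicity (chain f r) (toℕ u) (toℕ v)
    ; sym    = λ u v → cong (0 <ᵇ_) (multiplicity-sym (chain f r) (toℕ u) (toℕ v))
    ; irrefl = λ v → cong (0 <ᵇ_) (noLoops (chain f r) (toℕ v))
    }

  order : Permutation′ N
  order = revelation-order N 3≤N

  toℕ-position : ∀ v → toℕ (order ⟨$⟩ˡ v) ≡ positionOf N (toℕ v)
  toℕ-position v = toℕ-fromℕ< _

  toℕ-revealed : ∀ p → toℕ (order ⟨$⟩ʳ p) ≡ revealedAt N (toℕ p)
  toℕ-revealed p = toℕ-fromℕ< _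

  parentℕ : ∀ f a → a < N → a ≢ 0 → Σ ℕ λ p → p < N × multiplicity (chain f r) a p ≡ 1 × positionOf N p < positionOf N a
  parentℕ f a a<N a≢0 with vertex-view r a a<N
  ... | source     = ⊥-elim (a≢0 refl)
  ... | sink       = 2 , <-≤-trans (s≤s (s≤s (s≤s z≤n))) 3≤N , sink-hub₀ f r , ≤-trans (s≤s (s≤s z≤n)) (∸-monoˡ-≤ 1 3≤N)
  ... | hubᵛ i i≤r = 0 , <-≤-trans (s≤s z≤n) 3≤N , hub-source f r i i≤r ,
                     subst (0 <_) (sym (positionOf-≥2 N (hub i) (hub≥2 i))) (∸-monoˡ-< (hub≥2 i) (s≤s z≤n))
  ... | leaf i j i≤r j<d = hub i , hub<N i i≤r , leaf-hub f r i j i≤r j<d ,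
                           subst₂ _<_ (sym (positionOf-≥2 N (hub i) (hub≥2 i))) (sym (positionOf-≥2 N (hub i + suc j) (≤-trans (hub≥2 i) (m≤m+n _ _))))
                                  (∸-monoˡ-< (m<m+n (hub i) z<s) (≤-trans (s≤s z≤n) (hub≥2 i)))

  parent : ∀ f (v : Fin N) → v ≢ zero →
           Σ (Fin N) λ p → Graph.adj (graph f) v p ≡ true × toℕ (order ⟨$⟩ˡ p) < toℕ (order ⟨$⟩ˡ v)
  parent f v v≢0 with parentℕ f (toℕ v) (toℕ<n v) (λ v≡0 → v≢0 (toℕ-injective v≡0))
  ... | p , p<N , v~p , p<v = fromℕ< p<N , adjacent , earlier
    where
    adjacent : Graph.adj (graph f) v (fromℕ< p<N) ≡ true
    adjacent rewrite toℕ-fromℕ< p<N = ≡1⇒0<ᵇ v~p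
    earlier : toℕ (order ⟨$⟩ˡ fromℕ< p<N) < toℕ (order ⟨$⟩ˡ v)
    earlier rewrite toℕ-position (fromℕ< p<N) | toℕ-position v | toℕ-fromℕ< p<N = p<v

  input : (ℕ → Bool) → Input
  input f = record
    { graph           = graph f
    ; nonempty        = s≤s z≤n
    ; order           = order
    ; prefixConnected = λ i → prefixes-connected (Graph.adj (graph f)) (Graph.sym (graph f))
                                (λ v → toℕ (order ⟨$⟩ˡ v)) zero (parent f) (toℕ i)
    }

  input-seriesParallel : ∀ f → SPInput (input f)
  input-seriesParallel f = chain f r , size-chain f r , Permutation.id ,
    λ u v → ≤1⇒≡indicator _ (simple-chain f r (toℕ u) (toℕ v))

  1<N : 1 < N
  1<N = <-≤-trans (s≤s (s≤s z≤n)) 3≤N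

  sourceV sinkV : Fin N
  sourceV = zero
  sinkV   = fromℕ< 1<N

  sourceSinkHub : ∀ i → i ≤ r → Subset N
  sourceSinkHub i i≤r = ⁅ sourceV ⁆ ∪ (⁅ sinkV ⁆ ∪ ⁅ fromℕ< (hub<N i i≤r) ⁆)

  ∣sourceSinkHub∣≤3 : ∀ i i≤r → ∣ sourceSinkHub i i≤r ∣ ≤ 3
  ∣sourceSinkHub∣≤3 i i≤r = begin
    ∣ ⁅ sourceV ⁆ ∪ (⁅ sinkV ⁆ ∪ ⁅ h ⁆) ∣           ≤⟨ ∣p∪q∣≤∣p∣+∣q∣ ⁅ sourceV ⁆ (⁅ sinkV ⁆ ∪ ⁅ h ⁆) ⟩
    ∣ ⁅ sourceV ⁆ ∣ + ∣ ⁅ sinkV ⁆ ∪ ⁅ h ⁆ ∣          ≤⟨ +-monoʳ-≤ ∣ ⁅ sourceV ⁆ ∣ (∣p∪q∣≤∣p∣+∣q∣ ⁅ sinkV ⁆ ⁅ h ⁆) ⟩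
    ∣ ⁅ sourceV ⁆ ∣ + (∣ ⁅ sinkV ⁆ ∣ + ∣ ⁅ h ⁆ ∣)    ≡⟨ cong₂ _+_ (∣⁅x⁆∣≡1 sourceV) (cong₂ _+_ (∣⁅x⁆∣≡1 sinkV) (∣⁅x⁆∣≡1 h)) ⟩
    3                                                 ∎
    where
    open ≤-Reasoning
    h : Fin N
    h = fromℕ< (hub<N i i≤r)

  sourceSinkHub-dominating : ∀ f i (i≤r : i ≤ r) → (∀ j → j ≤ r → f j ≡ false → j ≡ i) →
                             Dominating (input f) (sourceSinkHub i i≤r)
  sourceSinkHub-dominating f i i≤r fans-at-i v = dominate (vertex-view r (toℕ v) (toℕ<n v)) refl
    where
    D : Subset N
    D = sourceSinkHub i i≤r
    h : Fin N
    h = fromℕ< (hub<N i i≤r)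
    source∈D : sourceV ∈ D
    source∈D = x∈p∪q⁺ (inj₁ (x∈⁅x⁆ sourceV))
    sink∈D : sinkV ∈ D
    sink∈D = x∈p∪q⁺ {p = ⁅ sourceV ⁆} (inj₂ (x∈p∪q⁺ (inj₁ (x∈⁅x⁆ sinkV))))
    hub∈D : h ∈ D
    hub∈D = x∈p∪q⁺ {p = ⁅ sourceV ⁆} (inj₂ (x∈p∪q⁺ {p = ⁅ sinkV ⁆} (inj₂ (x∈⁅x⁆ h))))
    adjacent : ∀ (w : Fin N) → multiplicity (chain f r) (toℕ v) (toℕ w) ≡ 1 → Graph.adj (graph f) v w ≡ true
    adjacent w v~w = ≡1⇒0<ᵇ v~w
    dominate : ∀ {a} → Vertex r a → toℕ v ≡ a → ∃[ w ] (w ∈ D × (w ≡ v ⊎ Graph.adj (graph f) v w ≡ true))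
    dominate source       v≡0 = sourceV , source∈D , inj₁ (toℕ-injective (sym v≡0))
    dominate sink         v≡1 = sinkV , sink∈D , inj₁ (toℕ-injective (trans (toℕ-fromℕ< 1<N) (sym v≡1)))
    dominate (hubᵛ j j≤r) v≡hub = sourceV , source∈D , inj₂ (adjacent sourceV (subst (λ a → multiplicity (chain f r) a 0 ≡ 1) (sym v≡hub) (hub-source f r j j≤r)))
    dominate (leaf j k j≤r k<d) v≡leaf with f j in fj
    ... | true  = sinkV , sink∈D , inj₂ (adjacent sinkV (subst₂ (λ a b → multiplicity (chain f r) a b ≡ 1) (sym v≡leaf) (sym (toℕ-fromℕ< 1<N))
                                                        (leaf-sink f r j k j≤r fj k<d)))
    ... | false with fans-at-i j j≤r fj
    ...   | refl = h , hub∈D , inj₂ (adjacent h (subst₂ (λ a b → multiplicity (chain f r) a b ≡ 1) (sym v≡leaf) (sym (toℕ-fromℕ< (hub<N j i≤r)))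
                                                        (leaf-hub f r j k j≤r k<d)))

  OPT≤3 : ∀ f i → i ≤ r → (∀ j → j ≤ r → f j ≡ false → j ≡ i) → Σ ℕ λ opt → IsOPT (input f) opt × opt ≤ 3
  OPT≤3 f i i≤r fans-at-i with minimum-dominating (input f) (sourceSinkHub i i≤r) (sourceSinkHub-dominating f i i≤r fans-at-i)
  ... | opt , isOPT , opt≤∣D∣ = opt , isOPT , ≤-trans opt≤∣D∣ (∣sourceSinkHub∣≤3 i i≤r)

-- The adversary

filterᵇ-cong : ∀ {A : Set} {p q : A → Bool} → (∀ x → p x ≡ q x) → ∀ L → filterᵇ p L ≡ filterᵇ q L
filterᵇ-cong         p≗q []      = refl
filterᵇ-cong {q = q} p≗q (x ∷ L) rewrite p≗q x with q x
... | true  = cong (x ∷_) (filterᵇ-cong p≗q L)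
... | false = filterᵇ-cong p≗q L

module Adversary (A : OnlineAlg) (d r : ℕ) where
  open Construction d r public

  revealed-allowed : ∀ i → i ≤ r → ∀ k → k ≤ positionOf N (hub i) → Allowed i (revealedAt N k)
  revealed-allowed i i≤r zero    _   = inj₁ refl
  revealed-allowed i i≤r (suc k) k≤ =
    subst (Allowed i) (sym (revealedAt-≢ N k (<⇒≢ 2+k<N))) (inj₂ (s≤s (s≤s z≤n) , 2+k≤hub))
    where
    2+k≤hub : 2 + k ≤ hub i
    2+k≤hub = subst (2 + k ≤_) (m+[n∸m]≡n (≤-trans (s≤s z≤n) (hub≥2 i)))
                    (s≤s (subst (suc k ≤_) (positionOf-≥2 N (hub i) (hub≥2 i)) k≤))
    2+k<N : 2 + k < N
    2+k<N = ≤-<-trans 2+k≤hub (hub<N i i≤r)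

  history-agree : ∀ f g i (p : Fin N) → i ≤ r → toℕ p ≤ positionOf N (hub i) → (∀ j → j < i → f j ≡ g j) →
                  history (input f) p ≡ history (input g) p
  history-agree f g i p i≤r p≤hub f≡g =
    map-cong-local (All.map (λ {k} k≤p → reveal-agree k (≤ᵇ⇒≤ (toℕ k) (toℕ p) k≤p))
                            (all-filter (λ k → T? (toℕ k ≤ᵇ toℕ p)) (allFinL N)))
    where
    reveal-agree : ∀ k → toℕ k ≤ toℕ p → reveal (input f) (order ⟨$⟩ʳ k) ≡ reveal (input g) (order ⟨$⟩ʳ k)
    reveal-agree k k≤p = cong (toℕ v ,_) (cong (map toℕ) (filterᵇ-cong adj-agree (allFinL N)))
      where
      v : Fin N
      v = order ⟨$⟩ʳ k
      allowed : Allowed i (toℕ v)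
      allowed = subst (Allowed i) (sym (toℕ-revealed k)) (revealed-allowed i i≤r (toℕ k) (≤-trans k≤p p≤hub))
      adj-agree : ∀ w → (does (w Fin.≟ v) ∨ Graph.adj (graph f) v w) ≡ (does (w Fin.≟ v) ∨ Graph.adj (graph g) v w)
      adj-agree w = cong (λ m → does (w Fin.≟ v) ∨ (0 <ᵇ m)) (chain-agree f g i r f≡g (toℕ v) (toℕ w) allowed)

  selects : (ℕ → Bool) → ℕ → Bool
  selects f = member (selected (input f) A)

  selects-toℕ : ∀ f v → selects f (toℕ v) ≡ A (history (input f) (order ⟨$⟩ˡ v))
  selects-toℕ f = member-tabulate (λ v → A (history (input f) (order ⟨$⟩ˡ v)))

  ALG≡count-selects : ∀ f → ALG (input f) A ≡ count (selects f) N
  ALG≡count-selects f = ∣∣≡count-member (selected (input f) A)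

  selects-hub-agree : ∀ f g i → i ≤ r → (∀ j → j < i → f j ≡ g j) → selects f (hub i) ≡ selects g (hub i)
  selects-hub-agree f g i i≤r f≡g = begin
    selects f (hub i)                      ≡⟨ cong (selects f) (toℕ-fromℕ< (hub<N i i≤r)) ⟨
    selects f (toℕ h)                      ≡⟨ selects-toℕ f h ⟩
    A (history (input f) (order ⟨$⟩ˡ h))   ≡⟨ cong A (history-agree f g i (order ⟨$⟩ˡ h) i≤r position≤ f≡g) ⟩
    A (history (input g) (order ⟨$⟩ˡ h))   ≡⟨ selects-toℕ g h ⟨
    selects g (toℕ h)                      ≡⟨ cong (selects g) (toℕ-fromℕ< (hub<N i i≤r)) ⟩
    selects g (hub i)                      ∎
    where
    open ≡-Reasoning
    h : Fin N
    h = fromℕ< (hub<N i i≤r)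
    position≤ : toℕ (order ⟨$⟩ˡ h) ≤ positionOf N (hub i)
    position≤ = ≤-reflexive (trans (toℕ-position h) (cong (positionOf N) (toℕ-fromℕ< (hub<N i i≤r))))

  hubs-counted : ∀ g m → (∀ i → i < m → g (hub i) ≡ true) → m ≤ count g (hub m)
  hubs-counted g zero    _        = z≤n
  hubs-counted g (suc m) selected = begin
    suc m                                                     ≡⟨ +-comm 1 m ⟩
    m + 1                                                     ≤⟨ +-mono-≤ (hubs-counted g m (λ i i<m → selected i (m<n⇒m<1+n i<m)))
                                                                          (count-pos (λ k → g (hub m + k)) {suc d} 0 z<s hub-m) ⟩
    count g (hub m) + count (λ k → g (hub m + k)) (suc d)     ≡⟨ count-+ g (hub m) (suc d) ⟨
    count g (hub m + suc d)                                   ≡⟨ cong (count g) (trans (+-suc (hub m) d) (cong suc (+-comm (hub m) d))) ⟩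
    count g (hub (suc m))                                     ∎
    where
    open ≤-Reasoning
    hub-m : g (hub m + 0) ≡ true
    hub-m = trans (cong g (+-identityʳ (hub m))) (selected m (n<1+n m))

  ALG-all-hubs : ∀ f → (∀ i → i ≤ r → selects f (hub i) ≡ true) → suc r ≤ ALG (input f) A
  ALG-all-hubs f selected = subst (suc r ≤_) (sym (ALG≡count-selects f))
    (hubs-counted (selects f) (suc r) (λ i i<1+r → selected i (≤-pred i<1+r)))

  adj⇒multiplicity≡1 : ∀ f (u v : Fin N) → Graph.adj (graph f) u v ≡ true → multiplicity (chain f r) (toℕ u) (toℕ v) ≡ 1
  adj⇒multiplicity≡1 f u v u~v = on-simple (multiplicity (chain f r) (toℕ u) (toℕ v)) (simple-chain f r (toℕ u) (toℕ v)) u~v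
    where
    on-simple : ∀ m → m ≤ 1 → (0 <ᵇ m) ≡ true → m ≡ 1
    on-simple (suc zero)    _        _ = refl
    on-simple (suc (suc m)) (s≤s ()) _

  -- In a fan block whose hub is not selected, the middle leaf of each consecutive triple
  -- can only be dominated from within its triple.
  ALG-fan : ∀ f i Q → i ≤ r → Q * 3 ≤ d → f i ≡ false → selects f (hub i) ≡ false →
            Dominating (input f) (selected (input f) A) → Q ≤ ALG (input f) A
  ALG-fan f i Q i≤r Q*3≤d fi≡false hub-unselected dominating = begin
    Q                                                   ≤⟨ count-triples Q (λ k → selects f (suc (hub i) + k)) triple-selected ⟩
    count (λ k → selects f (suc (hub i) + k)) (Q * 3)   ≤⟨ count-window (selects f) (suc (hub i)) (Q * 3) N window ⟩
    count (selects f) N                                 ≡⟨ ALG≡count-selects f ⟨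
    ALG (input f) A                                     ∎
    where
    open ≤-Reasoning
    S : Subset N
    S = selected (input f) A
    window : suc (hub i) + Q * 3 ≤ N
    window = ≤-trans (s≤s (≤-trans (+-monoʳ-≤ (hub i) Q*3≤d) (≤-reflexive (+-comm (hub i) d)))) (hub-mono (s≤s i≤r))
    triple-selected : ∀ q → q < Q → Σ ℕ λ k → k < 3 × selects f (suc (hub i) + (q * 3 + k)) ≡ true
    triple-selected q q<Q = dominated (dominating v)
      where
      2+j<d : q * 3 + 2 < d
      2+j<d = ≤-trans (≤-reflexive (trans (sym (+-suc (q * 3) 2)) (+-comm (q * 3) 3))) (≤-trans (*-monoˡ-≤ 3 q<Q) Q*3≤d)
      j<d : q * 3 + 1 < d
      j<d = <-trans (+-monoʳ-< (q * 3) (n<1+n 1)) 2+j<d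
      v : Fin N
      v = fromℕ< (leaf<N i (q * 3 + 1) i≤r j<d)
      leaf-at : ∀ (w : Fin N) k → k < 3 → w ∈ S → toℕ w ≡ hub i + suc (q * 3 + k) →
                Σ ℕ λ k → k < 3 × selects f (suc (hub i) + (q * 3 + k)) ≡ true
      leaf-at w k k<3 w∈S w≡ = k , k<3 , trans (cong (selects f) (trans (sym (+-suc (hub i) (q * 3 + k))) (sym w≡))) (∈⇒member S w w∈S)
      neighbour : ∀ (w : Fin N) → w ∈ S → ∀ {a} → toℕ w ≡ a → FanNeighbour (hub i) (λ k → hub i + suc k) d (q * 3 + 1) a →
                  Σ ℕ λ k → k < 3 × selects f (suc (hub i) + (q * 3 + k)) ≡ true
      neighbour w w∈S w≡ hubⁿ = ⊥-elim (true≢false (trans (sym (∈⇒member S w w∈S)) (trans (cong (selects f) w≡) hub-unselected)))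
      neighbour w w∈S w≡ (prevⁿ j≡1+k) =
        leaf-at w 0 (s≤s z≤n) w∈S (trans w≡ (cong (λ k → hub i + suc k) (suc-injective (trans (sym j≡1+k) (+-suc (q * 3) 0)))))
      neighbour w w∈S w≡ nextⁿ = leaf-at w 2 (s≤s (s≤s (s≤s z≤n))) w∈S (trans w≡ (cong (λ z → hub i + suc z) (sym (+-suc (q * 3) 1))))
      neighbour w w∈S w≡ (sinkⁿ 2+j≡d) = ⊥-elim (<-irrefl (trans (+-suc (q * 3) 1) 2+j≡d) 2+j<d)
      dominated : ∃[ w ] (w ∈ S × (w ≡ v ⊎ Graph.adj (graph f) v w ≡ true)) → Σ ℕ λ k → k < 3 × selects f (suc (hub i) + (q * 3 + k)) ≡ true
      dominated (w , w∈S , inj₁ refl) = leaf-at w 1 (s≤s (s≤s z≤n)) w∈S (toℕ-fromℕ< _)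
      dominated (w , w∈S , inj₂ v~w) = neighbour w w∈S refl
        (leaf-neighbour f r i (q * 3 + 1) (toℕ w) i≤r fi≡false j<d
          (subst (λ a → multiplicity (chain f r) a (toℕ w) ≡ 1) (toℕ-fromℕ< _) (adj⇒multiplicity≡1 f v w v~w)))

module HardInput (A : OnlineAlg) (correct : CorrectOnSP A) (r : ℕ) where
  d : ℕ
  d = suc r * 3
  open Adversary A d r public

  record HardInstance : Set where
    field
      blocks    : ℕ → Bool
      ALG-large : suc r ≤ ALG (input blocks) A
      OPT-small : Σ ℕ λ opt → IsOPT (input blocks) opt × opt ≤ 3

  books : ℕ → Bool
  books _ = true

  hard-instance : HardInstance
  hard-instance = from-books (all-or-counterexample (λ i → selects books (hub i)) r)
    where
    from-books : (∀ i → i ≤ r → selects books (hub i) ≡ true) ⊎ Σ ℕ (λ i → i ≤ r × selects books (hub i) ≡ false) → HardInstance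
    from-books (inj₁ all-selected) = record
      { blocks    = books
      ; ALG-large = ALG-all-hubs books all-selected
      ; OPT-small = OPT≤3 books 0 z≤n (λ _ _ ())
      }
    from-books (inj₂ (i , i≤r , unselected-in-books)) = record
      { blocks    = fanAt
      ; ALG-large = ALG-fan fanAt i (suc r) i≤r ≤-refl fanAt-i unselected (correct (input fanAt) (input-seriesParallel fanAt))
      ; OPT-small = OPT≤3 fanAt i i≤r (λ j _ fanAt-j → ≡ᵇ≡true⇒≡ j i (Bool.not-injective {y = true} fanAt-j))
      }
      where
      fanAt : ℕ → Bool
      fanAt j = not (j ≡ᵇ i)
      fanAt-i : fanAt i ≡ false
      fanAt-i rewrite ≡⇒≡ᵇ≡true {i} refl = refl
      unselected : selects fanAt (hub i) ≡ false
      unselected = trans (selects-hub-agree fanAt books i i≤r (λ j j<i → cong not (≢⇒≡ᵇ≡false (<⇒≢ j<i)))) unselected-in-books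

hub-formula : ∀ d m → Chain.hub d m ≡ 2 + m * suc d
hub-formula d zero    = refl
hub-formula d (suc m) rewrite hub-formula d m = shuffle d (m * suc d)
  where
  shuffle : ∀ d x → suc (d + (2 + x)) ≡ 2 + (suc d + x)
  shuffle = solve-∀

-- Here n = 12b² + 26b + 16, so 9n < 121 (b + 2)² ≤ (11 (ALG - b))².
competitive-bound : ∀ b n opt alg → n ≡ 2 + suc (b + b + 1) * suc (suc (b + b + 1) * 3) → opt ≤ 3 → suc (b + b + 1) ≤ alg →
                    b < alg × n * opt ^ 2 < (11 * (alg ∸ b)) ^ 2
competitive-bound b n opt alg refl opt≤3 alg≥ = b<alg , (begin-strict
  n * opt ^ 2                ≤⟨ *-monoʳ-≤ n (^-monoˡ-≤ 2 opt≤3) ⟩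
  n * 9                      <⟨ m<m+n (n * 9) {1 + (13 * (b * b) + 250 * b + 339)} z<s ⟩
  n * 9 + (1 + (13 * (b * b) + 250 * b + 339)) ≡⟨ expand b ⟨
  (11 * (b + 2)) ^ 2         ≤⟨ ^-monoˡ-≤ 2 (*-monoʳ-≤ 11 b+2≤alg-b) ⟩
  (11 * (alg ∸ b)) ^ 2       ∎)
  where
  open ≤-Reasoning
  expand : ∀ b → 11 * (b + 2) * (11 * (b + 2) * 1) ≡ (2 + suc (b + b + 1) * suc (suc (b + b + 1) * 3)) * 9 + (1 + (13 * (b * b) + 250 * b + 339))
  expand = solve-∀
  b<alg : b < alg
  b<alg = <-≤-trans (s≤s (≤-trans (m≤m+n b b) (m≤m+n (b + b) 1))) alg≥
  b+2≤alg-b : b + 2 ≤ alg ∸ b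
  b+2≤alg-b = subst (_≤ alg ∸ b) (m+n∸m≡n b (b + 2)) (∸-monoˡ-≤ b (subst (_≤ alg) (reorder b) alg≥))
    where
    reorder : ∀ b → suc (b + b + 1) ≡ b + (b + 2)
    reorder = solve-∀

theorem11 : (A : OnlineAlg) → CorrectOnSP A →
    ∃[ k ] (1 ≤ k × (∀ (b : ℕ) → ∃[ I ] (SPInput I × ∃[ opt ] (IsOPT I opt ×
    (b < ALG I A × nVertices I * opt ^ 2 < (k * (ALG I A ∸ b)) ^ 2)))))
theorem11 A correct = 11 , s≤s z≤n , witness
  where
  witness : ∀ b → ∃[ I ] (SPInput I × ∃[ opt ] (IsOPT I opt × (b < ALG I A × nVertices I * opt ^ 2 < (11 * (ALG I A ∸ b)) ^ 2)))
  witness b = input blocks , input-seriesParallel blocks , opt , isOPT ,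
              competitive-bound b (nVertices (input blocks)) opt (ALG (input blocks) A) (hub-formula d (suc (b + b + 1))) opt≤3 ALG-large
    where
    open HardInput A correct (b + b + 1) using (d; input; input-seriesParallel; module HardInstance; hard-instance)
    open HardInstance hard-instance
    opt : ℕ
    opt = proj₁ OPT-small
    isOPT : IsOPT (input blocks) opt
    isOPT = proj₁ (proj₂ OPT-small)
    opt≤3 : opt ≤ 3
    opt≤3 = proj₂ (proj₂ OPT-small)
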